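{- Let $\Sigma$ be a ranked alphabet and $k\ge1$. For every deterministic $k$-head tree-walking automaton with nested pebbles $\mathcal A$ over $\Sigma$ there is a closed formula $\phi$ of FO+DTC$^k$ over $\Sigma$ such that $L(\mathcal A)=\{t\in T_\Sigma\mid t\models\phi\}$. That is, $\mathrm{DPTWA}^k\subseteq\mathrm{FO{+}DTC}^k$.
   Context: Trees: a ranked alphabet is a finite set $\Sigma$ with a map $\mathrm{rank}:\Sigma\to\mathbb{N}$; $T_\Sigma$ is the set of trees over $\Sigma$, where a node labelled $\sigma$ has exactly $\mathrm{rank}(\sigma)$ children, numbered $1,\dots,\mathrm{rank}(\sigma)$ (child number of the root is $0$). Logic: first-order logic over $\Sigma$ has node variables, atomic formulas $\mathrm{lab}_\sigma(x)$ ($x$ has label $\sigma$), $\mathrm{edg}_i(x,y)$ ($y$ is the $i$-th child of $x$), $x\le y$ ($x$ is an ancestor of $y$), $x=y$, and is closed under $\neg,\wedge,\vee,\exists,\forall$. $k$-ary transitive closure: for a formula $\phi$ with $k$-tuples $\bar x,\bar y$ of distinct free variables (other free variables fixed), $t\models\phi^*(\bar u,\bar v)$ iff there are $k$-tuples of nodes $\bar u_0=\bar u,\dots,\bar u_n=\bar v$ ($n\ge0$) with $t\models\phi(\bar u_i,\bar u_{i+1})$ for all $i<n$. It is deterministic if $\phi$ is functional: for every tree, every valuation of the other free variables and every $\bar u$ there is at most one $\bar v$ with $\phi(\bar u,\bar v)$. FO+DTC$^k$ is first-order logic with $k$-ary deterministic transitive closure; a closed formula defines the set of trees satisfying it. Automata: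 a $k$-head tree-walking automaton with nested pebbles is $\mathcal A=(Q,\Sigma,X,q_0,A,I)$: finite states $Q$, finite pebble set $X$, initial state $q_0$, accepting states $A$, finite instruction set $I$ of triples $\langle p,\chi,q\rangle$ with $\chi$ one of $\mathrm{up}_i$, $\mathrm{down}_{i,j}$, $\mathrm{drop}_i(x)$, $\mathrm{retrieve}(x)$, $\mathrm{lab}_{i,\sigma}$, $\mathrm{peb}_i(x)$, $\mathrm{chno}_{i,j}$, or a negated test $\neg\mathrm{lab}_{i,\sigma}$, $\neg\mathrm{peb}_i(x)$, $\neg\mathrm{chno}_{i,j}$ ($1\le i\le k$, $x\in X$). Configurations on $t$ are $[p,\bar u,\alpha]$: state, $k$-tuple of head nodes, stack $\alpha$ of pairs (pebble, node). Semantics: $\mathrm{up}_i$/$\mathrm{down}_{i,j}$ move head $i$ to the parent/$j$-th child; $\mathrm{drop}_i(x)$ pushes $(x,u[i])$ if $x$ is not on the stack; $\mathrm{retrieve}(x)$ pops the top pair if its pebble is $x$ (no head needs to be at that node); tests $\mathrm{lab}_{i,\sigma}$, $\mathrm{peb}_i(x)$, $\mathrm{chno}_{i,j}$ succeed iff $u[i]$ has label $\sigma$, resp. $(x,u[i])$ is on the stack, resp. $u[i]$ has child number $j$ (negated tests iff the test fails), changing nothing else. A configuration is halting if no instruction applies. $t\in L(\mathcal A)$ iff from $[q_0,\overline{\mathrm{root}},\varepsilon]$ (all heads at the root, empty stack) some halting configuration $[p,\overline{\mathrm{root}},\varepsilon]$ with $p\in A$ is reachable. $\mathcal A$ is deterministic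 if any two distinct instructions from the same state have tests $\chi_1,\chi_2$ with $\chi_1=\neg\chi_2$ or $\chi_2=\neg\chi_1$. $\mathrm{DPTWA}^k$ denotes the family of languages accepted by deterministic such automata. -}

module Defs where

open import Data.Nat using (ℕ; zero; suc; _≡ᵇ_)
open import Data.Bool using (Bool; true; false; _∨_; if_then_else_)
open import Data.Fin using (Fin; toℕ)
open import Data.List using (List; []; _∷_; _++_)
open import Data.List.Relation.Unary.Any using (Any)
open import Data.List.Membership.Propositional using (_∈_)
open import Data.List.Relation.Unary.Unique.Propositional using (Unique)
open import Data.Vec using (Vec; []; _∷_; lookup; _[_]≔_; replicate; toList) renaming (map to vmap; _++_ to _++ᵥ_)
open import Data.Product using (Σ; Σ-syntax; _×_; _,_; proj₁)
open import Data.Sum using (_⊎_)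
open import Data.Empty using (⊥)
open import Data.Unit using (⊤)
open import Relation.Nullary using (¬_)
open import Relation.Binary.PropositionalEquality using (_≡_; _≢_)
open import Relation.Binary.Construct.Closure.ReflexiveTransitive using (Star)

record RankedAlphabet : Set where
  field
    size : ℕ
    rank : Fin size → ℕ

module _ (Γ : RankedAlphabet) where
  open RankedAlphabet Γ

  Symbol : Set
  Symbol = Fin size

  -- A node labelled σ has exactly rank σ children (child j : Fin (rank σ)
  -- is child number toℕ j + 1).
  data Tree : Set where
    node : (σ : Symbol) → (Fin (rank σ) → Tree) → Tree

module _ {Γ : RankedAlphabet} where
  open RankedAlphabet Γ

  data Pos : Tree Γ → Set where
    here  : ∀ {t} → Pos t
    there : ∀ {σ ts} (j : Fin (rank σ)) → Pos (ts j) → Pos (node σ ts)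

  root : ∀ {t} → Pos t
  root = here

  labelAt : (t : Tree Γ) → Pos t → Symbol Γ
  labelAt (node σ ts) here = σ
  labelAt (node σ ts) (there j p) = labelAt (ts j) p

  -- Edge t i u v : v is the i-th child of u (children numbered from 1).
  data Edge : (t : Tree Γ) → ℕ → Pos t → Pos t → Set where
    top    : ∀ {σ ts} (j : Fin (rank σ)) →
             Edge (node σ ts) (suc (toℕ j)) here (there j here)
    deeper : ∀ {σ ts j i u v} → Edge (ts j) i u v →
             Edge (node σ ts) i (there j u) (there j v)

  -- Anc t u v : u is an ancestor of v (reflexive).
  data Anc : (t : Tree Γ) → Pos t → Pos t → Set where
    anc-here  : ∀ {t v} → Anc t here v
    anc-there : ∀ {σ ts j u v} → Anc (ts j) u v →
                Anc (node σ ts) (there j u) (there j v)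

  -- ChNo t u j : u has child number j (the root has child number 0).
  ChNo : (t : Tree Γ) → Pos t → ℕ → Set
  ChNo t u j = (u ≡ here × j ≡ 0) ⊎ (Σ[ v ∈ Pos t ] Edge t j v u)

module _ (Γ : RankedAlphabet) (k nX : ℕ) where
  open RankedAlphabet Γ

  data BaseTest : Set where
    labT  : Fin k → Symbol Γ → BaseTest
    pebT  : Fin k → Fin nX → BaseTest
    chnoT : Fin k → ℕ → BaseTest

  data Cmd : Set where
    up       : Fin k → Cmd
    down     : Fin k → ℕ → Cmd
    drop     : Fin k → Fin nX → Cmd
    retrieve : Fin nX → Cmd
    test     : Bool → BaseTest → Cmd           -- test true T = T, test false T = ¬T

record PTWA (Γ : RankedAlphabet) (k : ℕ) : Set where
  field
    nQ : ℕ
    nX : ℕ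
    q₀ : Fin nQ
    accepting : Fin nQ → Bool
    instrs : List (Fin nQ × Cmd Γ k nX × Fin nQ)

module _ {Γ : RankedAlphabet} {k : ℕ} (A : PTWA Γ k) where
  open PTWA A

  Instr : Set
  Instr = Fin nQ × Cmd Γ k nX × Fin nQ

  src : Instr → Fin nQ
  src (p , _ , _) = p

  cmd : Instr → Cmd Γ k nX
  cmd (_ , c , _) = c

  IsNegOf : Cmd Γ k nX → Cmd Γ k nX → Set
  IsNegOf χ₁ χ₂ = Σ[ T ∈ BaseTest Γ k nX ] (χ₁ ≡ test false T × χ₂ ≡ test true T)

  Deterministic : Set
  Deterministic = ∀ {ι₁ ι₂} → ι₁ ∈ instrs → ι₂ ∈ instrs → ι₁ ≢ ι₂ →
    src ι₁ ≡ src ι₂ → IsNegOf (cmd ι₁) (cmd ι₂) ⊎ IsNegOf (cmd ι₂) (cmd ι₁)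

  module _ (t : Tree Γ) where
    Heads : Set
    Heads = Vec (Pos t) k

    -- stack, top of the stack is the head of the list
    Stack : Set
    Stack = List (Fin nX × Pos t)

    Config : Set
    Config = Fin nQ × Heads × Stack

    HoldsBase : BaseTest Γ k nX → Heads → Stack → Set
    HoldsBase (labT i σ)  us α = labelAt t (lookup us i) ≡ σ
    HoldsBase (pebT i x)  us α = (x , lookup us i) ∈ α
    HoldsBase (chnoT i j) us α = ChNo t (lookup us i) j

    Holds : Bool → BaseTest Γ k nX → Heads → Stack → Set
    Holds true  T us α = HoldsBase T us α
    Holds false T us α = ¬ HoldsBase T us α

    data Apply : Cmd Γ k nX → Heads → Stack → Heads → Stack → Set where
      a-up       : ∀ {i j v us α} → Edge t j v (lookup us i) →
                   Apply (up i) us α (us [ i ]≔ v) α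
      a-down     : ∀ {i j v us α} → Edge t j (lookup us i) v →
                   Apply (down i j) us α (us [ i ]≔ v) α
      a-drop     : ∀ {i x us α} → ¬ Any (λ pr → proj₁ pr ≡ x) α →
                   Apply (drop i x) us α us ((x , lookup us i) ∷ α)
      a-retrieve : ∀ {x u us α} → Apply (retrieve x) us ((x , u) ∷ α) us α
      a-test     : ∀ {b T us α} → Holds b T us α → Apply (test b T) us α us α

    data Step : Config → Config → Set where
      step : ∀ {p χ q us α us' α'} → (p , χ , q) ∈ instrs →
             Apply χ us α us' α' → Step (p , us , α) (q , us' , α')

    Halting : Config → Set
    Halting c = ∀ c' → ¬ Step c c'

    Accepts : Set
    Accepts = Σ[ p ∈ Fin nQ ] (accepting p ≡ true ×
      Star Step (q₀ , replicate k root , []) (p , replicate k root , []) ×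
      Halting (p , replicate k root , []))

Var : Set
Var = ℕ

module _ (Γ : RankedAlphabet) (k : ℕ) where
  data Formula : Set where
    labF  : Symbol Γ → Var → Formula
    edgF  : ℕ → Var → Var → Formula
    leqF  : Var → Var → Formula
    eqF   : Var → Var → Formula
    notF  : Formula → Formula
    andF  : Formula → Formula → Formula
    orF   : Formula → Formula → Formula
    exF   : Var → Formula → Formula
    allF  : Var → Formula → Formula
    tcF   : Vec Var k → Vec Var k → Formula → Vec Var k → Vec Var k → Formula

module _ {Γ : RankedAlphabet} {k : ℕ} where

  upd : ∀ {t : Tree Γ} → (Var → Pos t) → Var → Pos t → (Var → Pos t)
  upd ρ x u y = if y ≡ᵇ x then u else ρ y

  updV : ∀ {t : Tree Γ} {m} → (Var → Pos t) → Vec Var m → Vec (Pos t) m → (Var → Pos t)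
  updV ρ [] [] = ρ
  updV ρ (x ∷ xs) (u ∷ us) = updV (upd ρ x u) xs us

  ⟦_⟧ : Formula Γ k → (t : Tree Γ) → (Var → Pos t) → Set
  ⟦ labF σ x ⟧ t ρ = labelAt t (ρ x) ≡ σ
  ⟦ edgF i x y ⟧ t ρ = Edge t i (ρ x) (ρ y)
  ⟦ leqF x y ⟧ t ρ = Anc t (ρ x) (ρ y)
  ⟦ eqF x y ⟧ t ρ = ρ x ≡ ρ y
  ⟦ notF φ ⟧ t ρ = ¬ ⟦ φ ⟧ t ρ
  ⟦ andF φ ψ ⟧ t ρ = ⟦ φ ⟧ t ρ × ⟦ ψ ⟧ t ρ
  ⟦ orF φ ψ ⟧ t ρ = ⟦ φ ⟧ t ρ ⊎ ⟦ ψ ⟧ t ρ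
  ⟦ exF x φ ⟧ t ρ = Σ[ u ∈ Pos t ] ⟦ φ ⟧ t (upd ρ x u)
  ⟦ allF x φ ⟧ t ρ = (u : Pos t) → ⟦ φ ⟧ t (upd ρ x u)
  ⟦ tcF xs ys φ us vs ⟧ t ρ =
    Star (λ a b → ⟦ φ ⟧ t (updV (updV ρ xs a) ys b)) (vmap ρ us) (vmap ρ vs)

  Functional : Formula Γ k → Vec Var k → Vec Var k → Set
  Functional φ xs ys = ∀ (t : Tree Γ) (ρ : Var → Pos t) (a b b' : Vec (Pos t) k) →
    ⟦ φ ⟧ t (updV (updV ρ xs a) ys b) → ⟦ φ ⟧ t (updV (updV ρ xs a) ys b') → b ≡ b'

  IsDTC : Formula Γ k → Set
  IsDTC (labF _ _) = ⊤
  IsDTC (edgF _ _ _) = ⊤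
  IsDTC (leqF _ _) = ⊤
  IsDTC (eqF _ _) = ⊤
  IsDTC (notF φ) = IsDTC φ
  IsDTC (andF φ ψ) = IsDTC φ × IsDTC ψ
  IsDTC (orF φ ψ) = IsDTC φ × IsDTC ψ
  IsDTC (exF _ φ) = IsDTC φ
  IsDTC (allF _ φ) = IsDTC φ
  IsDTC (tcF xs ys φ us vs) =
    Unique (toList (xs ++ᵥ ys)) × Functional φ xs ys × IsDTC φ

  elemᵇ : Var → List Var → Bool
  elemᵇ y [] = false
  elemᵇ y (z ∷ zs) = (y ≡ᵇ z) ∨ elemᵇ y zs

  without : List Var → List Var → List Var
  without [] zs = []
  without (y ∷ ys) zs = if elemᵇ y zs then without ys zs else y ∷ without ys zs

  fv : Formula Γ k → List Var
  fv (labF _ x) = x ∷ []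
  fv (edgF _ x y) = x ∷ y ∷ []
  fv (leqF x y) = x ∷ y ∷ []
  fv (eqF x y) = x ∷ y ∷ []
  fv (notF φ) = fv φ
  fv (andF φ ψ) = fv φ ++ fv ψ
  fv (orF φ ψ) = fv φ ++ fv ψ
  fv (exF x φ) = without (fv φ) (x ∷ [])
  fv (allF x φ) = without (fv φ) (x ∷ [])
  fv (tcF xs ys φ us vs) =
    without (fv φ) (toList (xs ++ᵥ ys)) ++ toList us ++ toList vs

  Closed : Formula Γ k → Set
  Closed φ = fv φ ≡ []

  -- t ⊨ φ for closed φ (the valuation is irrelevant; we use the root)
  _⊨_ : Tree Γ → Formula Γ k → Set
  t ⊨ φ = ⟦ φ ⟧ t (λ _ → root)

-- Tuples of k node variables hold the positions of the k heads, so a configuration without its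
-- state and stack is a tuple of the kind FO+DTCᵏ can iterate over. States are eliminated as in
-- McNaughton–Yamada: a path whose intermediate states lie in r ∷ L either avoids r, or goes to r,
-- loops at r (a transitive closure over k-tuples) and leaves r, all within L. The loop relation is
-- deterministic because the automaton is: a path from r back to r that does not meet r in between
-- is determined by its start. Pebbles are handled by recursion on the nesting depth: a
-- drop … retrieve excursion is one step at the outer stack, expressed by the reachability formula
-- for the inner stack, where the new pebble is the node of the dropping head, still held by a free
-- variable. Pebbles on the stack are distinct, so the depth is at most the number of pebbles.

module Submission where

open import Defs

open import Data.Bool using (Bool; true; false)
open import Data.Bool.Properties using (∨-zeroʳ) renaming (_≟_ to _≟ᵇ_)
open import Data.Empty using (⊥; ⊥-elim)
open import Data.Fin using (Fin; toℕ; zero; suc)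
open import Data.Fin.Properties using (toℕ-injective; toℕ<n; injective⇒≤) renaming (_≟_ to _≟ᶠ_)
open import Data.List using (List; []; _∷_; length; foldr; allFin; upTo)
import Data.List as List
open import Data.List.Properties using (length-map)
open import Data.List.Membership.Propositional using (_∈_; _∉_; find; lose)
open import Data.List.Membership.Propositional.Properties using (∈-allFin; ∈-upTo⁺; ∈-lookup)
import Data.List.Membership.DecPropositional as DecMembership
open import Data.List.Relation.Unary.All as All using (All; []; _∷_)
open import Data.List.Relation.Unary.All.Properties using (All¬⇒¬Any; ¬Any⇒All¬; ++⁺)
open import Data.List.Relation.Unary.AllPairs using ([]; _∷_)
open import Data.List.Relation.Unary.Any as Any using (Any; here; there)
import Data.List.Relation.Unary.Any.Properties as Any
open import Data.List.Relation.Unary.Unique.Propositional using (Unique)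
open import Data.List.Relation.Unary.Unique.Propositional.Properties using (allFin⁺)
open import Data.Nat using (ℕ; zero; suc; _+_; _≤_; _<_; _≡ᵇ_; _⊔_; s≤s)
open import Data.Nat.Properties
  using ( suc-injective; +-suc; +-identityʳ; ≤-refl; ≤-trans; <-trans; <-≤-trans; <-irrefl
        ; n<1+n; n≤1+n; m≤m+n; m≤m⊔n; m≤n⊔m; m<n⇒m<1+n; m<1+n⇒m<n∨m≡n )
  renaming (_≟_ to _≟ⁿ_)
open import Data.Product using (Σ-syntax; ∃-syntax; _×_; _,_; proj₁; proj₂)
open import Data.Product.Properties using (×-≡,≡→≡; ×-≡,≡←≡) renaming (≡-dec to ≡-dec×)
open import Data.Product.Function.Dependent.Propositional using (Σ-⇔)
open import Data.Product.Function.NonDependent.Propositional using (_×-⇔_)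
open import Data.Sum using (_⊎_; inj₁; inj₂; [_,_]′)
import Data.Sum as Sum
open import Data.Sum.Properties using () renaming (≡-dec to ≡-dec⊎)
open import Data.Sum.Function.Propositional using (_⊎-⇔_)
open import Data.Unit using (tt)
open import Data.Vec using (Vec; []; _∷_; lookup; _[_]≔_; toList; replicate)
  renaming (map to vmap; _++_ to _++ᵥ_)
open import Data.Vec.Properties using (∷-injective; lookup-map; map-[]≔; lookup∘update)
import Data.Vec.Relation.Unary.All as AllV
open import Data.Vec.Relation.Unary.All.Properties using (lookup⁺; toList⁺)
open import Function using (_∘_; id)
open import Function.Bundles using (_⇔_; mk⇔; Equivalence)
open import Function.Construct.Identity using (⇔-id; ↠-id)
open import Function.Properties.Equivalence using () renaming (trans to ⇔-trans; sym to ⇔-sym)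
open import Function.Related.TypeIsomorphisms using (¬-cong-⇔)
open import Relation.Binary.Construct.Closure.ReflexiveTransitive using (Star; ε; _◅_; _◅◅_)
import Relation.Binary.Construct.Closure.ReflexiveTransitive as Star
open import Relation.Binary.Definitions using (DecidableEquality)
open import Relation.Binary.PropositionalEquality
  using (_≡_; _≢_; refl; sym; trans; cong; cong₂; subst; subst₂)
open import Relation.Binary.Rewriting using () renaming (Deterministic to Deterministicᴿ)
open import Relation.Nullary using (¬_; Dec; yes; no; ¬?)
open import Relation.Nullary.Decidable using (map′; dec-true; dec-false)

open Equivalence using (to; from)

-- Deterministic paths and state elimination

star-linear : ∀ {I : Set} {R : I → I → Set} → Deterministicᴿ _≡_ R →
  ∀ {a b c} → Star R a b → Star R a c → Star R b c ⊎ Star R c b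
star-linear det ε π = inj₁ π
star-linear det (s ◅ π) ε = inj₂ (s ◅ π)
star-linear det (s ◅ π) (s′ ◅ π′) with refl ← det s s′ = star-linear det π π′

module StateElimination {V : Set} {n : ℕ} (R : Fin n × V → Fin n × V → Set) where

  -- A nonempty R-path from (p , u) to (q , v) whose intermediate states lie in L.
  Via : List (Fin n) → Fin n → Fin n → V → V → Set
  Via [] p q u v = R (p , u) (q , v)
  Via (r ∷ L) p q u v = Via L p q u v ⊎
    ∃[ w ] ∃[ w′ ] (Via L p r u w × Star (Via L r r) w w′ × Via L r q w′ v)

  via-step : ∀ L {p q u v} → R (p , u) (q , v) → Via L p q u v
  via-step [] s = s
  via-step (r ∷ L) s = inj₁ (via-step L s)

  via-sound : ∀ L {p q u v} → Via L p q u v → Star R (p , u) (q , v)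
  via-sound [] s = s ◅ ε
  via-sound (r ∷ L) (inj₁ π) = via-sound L π
  via-sound (r ∷ L) (inj₂ (_ , _ , π , loops , π′)) =
    via-sound L π ◅◅ loops-sound loops ◅◅ via-sound L π′
    where
    loops-sound : ∀ {w w′} → Star (Via L r r) w w′ → Star R (r , w) (r , w′)
    loops-sound ε = ε
    loops-sound (π ◅ πs) = via-sound L π ◅◅ loops-sound πs

  via-cons : ∀ L {p r q u w v} → R (p , u) (r , w) → r ∈ L → Via L r q w v → Via L p q u v
  via-cons (r′ ∷ L) s (there r∈L) (inj₁ π) = inj₁ (via-cons L s r∈L π)
  via-cons (r′ ∷ L) s (there r∈L) (inj₂ (w , w′ , π , loops , π′)) =
    inj₂ (w , w′ , via-cons L s r∈L π , loops , π′)
  via-cons (r ∷ L) {w = w} s (here refl) (inj₁ π) = inj₂ (w , w , via-step L s , ε , π)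
  via-cons (r ∷ L) {w = w} s (here refl) (inj₂ (_ , w′ , π , loops , π′)) =
    inj₂ (w , w′ , via-step L s , π ◅ loops , π′)

  via-complete : ∀ L → (∀ r → r ∈ L) → ∀ {p q u v} →
    Star R (p , u) (q , v) → (p , u) ≡ (q , v) ⊎ Via L p q u v
  via-complete L all ε = inj₁ refl
  via-complete L all (_◅_ {j = r , w} s π) with via-complete L all π
  ... | inj₁ refl = inj₂ (via-step L s)
  ... | inj₂ π′ = inj₂ (via-cons L s (all r) π′)

  via-deterministic : Deterministicᴿ _≡_ R → ∀ L → Unique L → ∀ {p q q′ u v v′} → q ∉ L → q′ ∉ L →
    Via L p q u v → Via L p q′ u v′ → (q , v) ≡ (q′ , v′)
  via-deterministic det [] _ _ _ π π′ = det π π′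
  via-deterministic det (r ∷ L) (r≢L ∷ L!) {p} {q} {q′} {u} {v} {v′} q∉ q′∉ = go
    where
    r∉L : r ∉ L
    r∉L = All¬⇒¬Any r≢L

    ih : ∀ {p q q′ u v v′} → q ∉ L → q′ ∉ L → Via L p q u v → Via L p q′ u v′ → (q , v) ≡ (q′ , v′)
    ih = via-deterministic det L L!

    loop-det : Deterministicᴿ _≡_ (Via L r r)
    loop-det π π′ = cong proj₂ (ih r∉L r∉L π π′)

    go : Via (r ∷ L) p q u v → Via (r ∷ L) p q′ u v′ → (q , v) ≡ (q′ , v′)
    go (inj₁ π) (inj₁ π′) = ih (q∉ ∘ there) (q′∉ ∘ there) π π′
    go (inj₁ π) (inj₂ (_ , _ , π′ , _)) with () ← q∉ (here (cong proj₁ (ih (q∉ ∘ there) r∉L π π′)))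
    go (inj₂ (_ , _ , π , _)) (inj₁ π′) with () ← q′∉ (here (cong proj₁ (ih (q′∉ ∘ there) r∉L π′ π)))
    go (inj₂ (_ , _ , π₁ , loops , π₂)) (inj₂ (_ , _ , π₁′ , loops′ , π₂′))
      with refl ← ih r∉L r∉L π₁ π₁′
      with star-linear loop-det loops loops′
    ... | inj₁ ε = ih (q∉ ∘ there) (q′∉ ∘ there) π₂ π₂′
    ... | inj₂ ε = ih (q∉ ∘ there) (q′∉ ∘ there) π₂ π₂′
    ... | inj₁ (π ◅ _) with () ← q∉ (here (sym (cong proj₁ (ih r∉L (q∉ ∘ there) π π₂))))
    ... | inj₂ (π ◅ _) with () ← q′∉ (here (sym (cong proj₁ (ih r∉L (q′∉ ∘ there) π π₂′))))

maxRank : RankedAlphabet → ℕ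
maxRank Γ = foldr (λ σ m → rank σ ⊔ m) 0 (allFin size)
  where open RankedAlphabet Γ

module _ {Γ : RankedAlphabet} where
  open RankedAlphabet Γ

  edge-parent-unique : ∀ {t : Tree Γ} {i j u v v′} → Edge t i v u → Edge t j v′ u → v ≡ v′
  edge-parent-unique (top j) (top .j) = refl
  edge-parent-unique (deeper e) (deeper e′) = cong (there _) (edge-parent-unique e e′)

  edge-child-unique : ∀ {t : Tree Γ} {i j u v v′} → Edge t i u v → Edge t j u v′ → i ≡ j → v ≡ v′
  edge-child-unique (top j) (top j′) i≡j = cong (λ j → there j here) (toℕ-injective (suc-injective i≡j))
  edge-child-unique (deeper e) (deeper e′) i≡j = cong (there _) (edge-child-unique e e′ i≡j)

  edge-index-nonzero : ∀ {t : Tree Γ} {u v} → ¬ Edge t 0 u v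
  edge-index-nonzero (deeper e) = edge-index-nonzero e

  anc-root : ∀ {t : Tree Γ} {u} → Anc t u root → u ≡ root
  anc-root anc-here = refl

  rank≤maxRank : ∀ σ → rank σ ≤ maxRank Γ
  rank≤maxRank σ = go (allFin size) (∈-allFin σ)
    where
    go : ∀ σs → σ ∈ σs → rank σ ≤ foldr (λ σ m → rank σ ⊔ m) 0 σs
    go (_ ∷ σs) (here refl) = m≤m⊔n _ _
    go (τ ∷ σs) (there σ∈σs) = ≤-trans (go σs σ∈σs) (m≤n⊔m (rank τ) _)

  edge-index-bound : ∀ {t : Tree Γ} {i u v} → Edge t i u v → ∃[ j ] i ≡ suc j × j < maxRank Γ
  edge-index-bound (top {σ} j) = toℕ j , refl , <-≤-trans (toℕ<n j) (rank≤maxRank σ)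
  edge-index-bound (deeper e) = edge-index-bound e

module _ {Γ : RankedAlphabet} {k nX : ℕ} where
  open RankedAlphabet Γ

  data IsMove : Cmd Γ k nX → Set where
    up   : ∀ i → IsMove (up i)
    down : ∀ i j → IsMove (down i j)
    test : ∀ b T → IsMove (test b T)

  private
    TestCode : Set
    TestCode = (Fin k × Fin size) ⊎ (Fin k × Fin nX) ⊎ (Fin k × ℕ)

    CmdCode : Set
    CmdCode = Fin k ⊎ (Fin k × ℕ) ⊎ (Fin k × Fin nX) ⊎ Fin nX ⊎ (Bool × TestCode)

    _≟-code_ : DecidableEquality CmdCode
    _≟-code_ =
      ≡-dec⊎ _≟ᶠ_ (≡-dec⊎ (≡-dec× _≟ᶠ_ _≟ⁿ_) (≡-dec⊎ (≡-dec× _≟ᶠ_ _≟ᶠ_) (≡-dec⊎ _≟ᶠ_ (≡-dec× _≟ᵇ_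
        (≡-dec⊎ (≡-dec× _≟ᶠ_ _≟ᶠ_) (≡-dec⊎ (≡-dec× _≟ᶠ_ _≟ᶠ_) (≡-dec× _≟ᶠ_ _≟ⁿ_)))))))

    encode : Cmd Γ k nX → CmdCode
    encode (up i) = inj₁ i
    encode (down i j) = inj₂ (inj₁ (i , j))
    encode (drop i x) = inj₂ (inj₂ (inj₁ (i , x)))
    encode (retrieve x) = inj₂ (inj₂ (inj₂ (inj₁ x)))
    encode (test b (labT i σ)) = inj₂ (inj₂ (inj₂ (inj₂ (b , inj₁ (i , σ)))))
    encode (test b (pebT i x)) = inj₂ (inj₂ (inj₂ (inj₂ (b , inj₂ (inj₁ (i , x))))))
    encode (test b (chnoT i j)) = inj₂ (inj₂ (inj₂ (inj₂ (b , inj₂ (inj₂ (i , j))))))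

    decode : CmdCode → Cmd Γ k nX
    decode (inj₁ i) = up i
    decode (inj₂ (inj₁ (i , j))) = down i j
    decode (inj₂ (inj₂ (inj₁ (i , x)))) = drop i x
    decode (inj₂ (inj₂ (inj₂ (inj₁ x)))) = retrieve x
    decode (inj₂ (inj₂ (inj₂ (inj₂ (b , inj₁ (i , σ)))))) = test b (labT i σ)
    decode (inj₂ (inj₂ (inj₂ (inj₂ (b , inj₂ (inj₁ (i , x))))))) = test b (pebT i x)
    decode (inj₂ (inj₂ (inj₂ (inj₂ (b , inj₂ (inj₂ (i , j))))))) = test b (chnoT i j)

    decode-encode : ∀ χ → decode (encode χ) ≡ χ
    decode-encode (up i) = refl
    decode-encode (down i j) = refl
    decode-encode (drop i x) = refl
    decode-encode (retrieve x) = refl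
    decode-encode (test b (labT i σ)) = refl
    decode-encode (test b (pebT i x)) = refl
    decode-encode (test b (chnoT i j)) = refl

  _≟-cmd_ : DecidableEquality (Cmd Γ k nX)
  χ ≟-cmd χ′ = map′ encode-injective (cong encode) (encode χ ≟-code encode χ′)
    where
    encode-injective : encode χ ≡ encode χ′ → χ ≡ χ′
    encode-injective eq = trans (sym (decode-encode χ)) (trans (cong decode eq) (decode-encode χ′))

-- Runs at a fixed stack

module Runs {Γ : RankedAlphabet} {k : ℕ} (A : PTWA Γ k) (t : Tree Γ) where
  open PTWA A

  Point : Set
  Point = Fin nQ × Heads A t

  at : Stack A t → Point → Config A t
  at α (p , us) = p , us , α

  -- A step at stack α; a whole drop … retrieve excursion above α counts as one step.
  data LevelStep (α : Stack A t) : Point → Point → Set where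
    move      : ∀ {p χ q us us′} → (p , χ , q) ∈ instrs → IsMove χ → Apply A t χ us α us′ α →
                LevelStep α (p , us) (q , us′)
    excursion : ∀ {p i x p′ r q us us′} → (p , drop i x , p′) ∈ instrs → ¬ Any ((_≡ x) ∘ proj₁) α →
                Star (LevelStep ((x , lookup us i) ∷ α)) (p′ , us) (r , us′) →
                (r , retrieve x , q) ∈ instrs → LevelStep α (p , us) (q , us′)

  Excursion : Stack A t → Fin k → Fin nX → Fin nQ → Fin nQ → Heads A t → Heads A t → Set
  Excursion α i x p′ q us us′ = ¬ Any ((_≡ x) ∘ proj₁) α ×
    ∃[ r ] Star (LevelStep ((x , lookup us i) ∷ α)) (p′ , us) (r , us′) × (r , retrieve x , q) ∈ instrs

  mutual
    levelStep-sound : ∀ {α c c′} → LevelStep α c c′ → Star (Step A t) (at α c) (at α c′)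
    levelStep-sound (move ι∈ _ a) = step ι∈ a ◅ ε
    levelStep-sound (excursion ι∈ x∉α π ι′∈) =
      step ι∈ (a-drop x∉α) ◅ levelStar-sound π ◅◅ step ι′∈ a-retrieve ◅ ε

    levelStar-sound : ∀ {α c c′} → Star (LevelStep α) c c′ → Star (Step A t) (at α c) (at α c′)
    levelStar-sound ε = ε
    levelStar-sound (s ◅ π) = levelStep-sound s ◅◅ levelStar-sound π

  -- A run from stack α down to the empty stack, cut at the retrieves that pop the pebbles of α.
  Unwinding : Stack A t → Point → Point → Set
  Unwinding [] c d = Star (LevelStep []) c d
  Unwinding ((x , u) ∷ α) c d = ∃[ r ] ∃[ ws ] ∃[ q ]
    Star (LevelStep ((x , u) ∷ α)) c (r , ws) × (r , retrieve x , q) ∈ instrs × Unwinding α (q , ws) d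

  unwinding-cons : ∀ {α c c′ d} → LevelStep α c c′ → Unwinding α c′ d → Unwinding α c d
  unwinding-cons {[]} s π = s ◅ π
  unwinding-cons {_ ∷ _} s (r , ws , q , π , ι∈ , rest) = r , ws , q , s ◅ π , ι∈ , rest

  unwind : ∀ {α p us q vs} → Star (Step A t) (p , us , α) (q , vs , []) → Unwinding α (p , us) (q , vs)
  unwind ε = ε
  unwind (step ι∈ (a-up e) ◅ π) = unwinding-cons (move ι∈ (up _) (a-up e)) (unwind π)
  unwind (step ι∈ (a-down e) ◅ π) = unwinding-cons (move ι∈ (down _ _) (a-down e)) (unwind π)
  unwind (step ι∈ (a-test h) ◅ π) = unwinding-cons (move ι∈ (test _ _) (a-test h)) (unwind π)
  unwind (step ι∈ (a-drop x∉α) ◅ π) with unwind π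
  ... | _ , _ , _ , π′ , ι′∈ , rest = unwinding-cons (excursion ι∈ x∉α π′ ι′∈) rest
  unwind (step ι∈ a-retrieve ◅ π) = _ , _ , _ , ε , ι∈ , unwind π

  levelStar-complete : ∀ {p us q vs} →
    Star (Step A t) (p , us , []) (q , vs , []) → Star (LevelStep []) (p , us) (q , vs)
  levelStar-complete = unwind

  apply-up-⇔ : ∀ {i us us′ α} →
    Apply A t (up i) us α us′ α ⇔ (∃[ v ] (∃[ j ] Edge t j v (lookup us i)) × us′ ≡ us [ i ]≔ v)
  apply-up-⇔ = mk⇔ (λ { (a-up e) → _ , (_ , e) , refl }) (λ { (_ , (_ , e) , refl) → a-up e })

  apply-down-⇔ : ∀ {i j us us′ α} →
    Apply A t (down i j) us α us′ α ⇔ (∃[ v ] Edge t j (lookup us i) v × us′ ≡ us [ i ]≔ v)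
  apply-down-⇔ = mk⇔ (λ { (a-down e) → _ , e , refl }) (λ { (_ , e , refl) → a-down e })

  apply-test-⇔ : ∀ {b T us us′ α} →
    Apply A t (test b T) us α us′ α ⇔ (us ≡ us′ × Holds A t b T us α)
  apply-test-⇔ = mk⇔ (λ { (a-test h) → refl , h }) (λ { (refl , h) → a-test h })

  move-keeps-stack : ∀ {χ us α us′ α′} → IsMove χ → Apply A t χ us α us′ α′ → α′ ≡ α
  move-keeps-stack (up _) (a-up _) = refl
  move-keeps-stack (down _ _) (a-down _) = refl
  move-keeps-stack (test _ _) (a-test _) = refl

  apply-deterministic : ∀ {χ us α us₁ α₁ us₂ α₂} →
    Apply A t χ us α us₁ α₁ → Apply A t χ us α us₂ α₂ → us₁ ≡ us₂
  apply-deterministic (a-up e) (a-up e′) = cong (_ [ _ ]≔_) (edge-parent-unique e e′)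
  apply-deterministic (a-down e) (a-down e′) = cong (_ [ _ ]≔_) (edge-child-unique e e′ refl)
  apply-deterministic (a-drop _) (a-drop _) = refl
  apply-deterministic a-retrieve a-retrieve = refl
  apply-deterministic (a-test _) (a-test _) = refl

  _≟-instr_ : DecidableEquality (Instr A)
  _≟-instr_ = ≡-dec× _≟ᶠ_ (≡-dec× _≟-cmd_ _≟ᶠ_)

  module _ (det : Deterministic A) where

    non-test-instr-unique : ∀ {ι ι′} → ι ∈ instrs → ι′ ∈ instrs → src A ι ≡ src A ι′ →
      (∀ {b T} → cmd A ι ≢ test b T) → ι ≡ ι′
    non-test-instr-unique {ι} {ι′} ι∈ ι′∈ same non-test with ι ≟-instr ι′
    ... | yes ι≡ι′ = ι≡ι′
    ... | no ι≢ι′ with det ι∈ ι′∈ ι≢ι′ same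
    ...   | inj₁ (_ , is-test , _) = ⊥-elim (non-test is-test)
    ...   | inj₂ (_ , _ , is-test) = ⊥-elim (non-test is-test)

    retrieve-stuck : ∀ {α r y q ws c} → (r , retrieve y , q) ∈ instrs → ¬ LevelStep α (r , ws) c
    retrieve-stuck ι∈ (move ι′∈ _ _) with non-test-instr-unique ι∈ ι′∈ refl (λ ())
    retrieve-stuck ι∈ (move ι′∈ () _) | refl
    retrieve-stuck ι∈ (excursion ι′∈ _ _ _) with () ← non-test-instr-unique ι∈ ι′∈ refl (λ ())

    mutual
      levelStep-deterministic : ∀ {α} → Deterministicᴿ _≡_ (LevelStep α)
      levelStep-deterministic (move {p} {χ} {q} ι∈ _ a) (move {χ = χ′} {q′} ι′∈ _ a′)
        with (p , χ , q) ≟-instr (p , χ′ , q′)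
      ... | yes refl = cong (_ ,_) (apply-deterministic a a′)
      ... | no ι≢ι′ with det ι∈ ι′∈ ι≢ι′ refl | a | a′
      ...   | inj₁ (_ , refl , refl) | a-test ¬h | a-test h = ⊥-elim (¬h h)
      ...   | inj₂ (_ , refl , refl) | a-test h | a-test ¬h = ⊥-elim (¬h h)
      levelStep-deterministic (move ι∈ _ _) (excursion ι′∈ _ _ _) with non-test-instr-unique ι′∈ ι∈ refl (λ ())
      levelStep-deterministic (move ι∈ () _) (excursion ι′∈ _ _ _) | refl
      levelStep-deterministic (excursion ι∈ _ _ _) (move ι′∈ _ _) with non-test-instr-unique ι∈ ι′∈ refl (λ ())
      levelStep-deterministic (excursion ι∈ _ _ _) (move ι′∈ () _) | refl
      levelStep-deterministic (excursion ι∈ _ π ρ∈) (excursion ι′∈ _ π′ ρ′∈)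
        with refl ← non-test-instr-unique ι∈ ι′∈ refl (λ ())
        with refl ← retrieval-point-unique π π′ ρ∈ ρ′∈
        with refl ← non-test-instr-unique ρ∈ ρ′∈ refl (λ ()) = refl

      retrieval-point-unique : ∀ {α c r₁ y₁ q₁ ws₁ r₂ y₂ q₂ ws₂} →
        Star (LevelStep α) c (r₁ , ws₁) → Star (LevelStep α) c (r₂ , ws₂) →
        (r₁ , retrieve y₁ , q₁) ∈ instrs → (r₂ , retrieve y₂ , q₂) ∈ instrs → (r₁ , ws₁) ≡ (r₂ , ws₂)
      retrieval-point-unique ε ε _ _ = refl
      retrieval-point-unique ε (s ◅ _) ι₁∈ _ = ⊥-elim (retrieve-stuck ι₁∈ s)
      retrieval-point-unique (s ◅ _) ε _ ι₂∈ = ⊥-elim (retrieve-stuck ι₂∈ s)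
      retrieval-point-unique (s ◅ π) (s′ ◅ π′) ι₁∈ ι₂∈ with refl ← levelStep-deterministic s s′ =
        retrieval-point-unique π π′ ι₁∈ ι₂∈

varsFrom : Var → (m : ℕ) → Vec Var m
varsFrom c zero = []
varsFrom c (suc m) = c ∷ varsFrom (suc c) m

Below : ∀ {m} → Var → Vec Var m → Set
Below c xs = AllV.All (_< c) xs

below-mono : ∀ {c d m} {xs : Vec Var m} → c ≤ d → Below c xs → Below d xs
below-mono c≤d = AllV.map (λ x<c → <-≤-trans x<c c≤d)

below-update : ∀ {c m y} {xs : Vec Var m} i → Below c xs → y < c → Below c (xs [ i ]≔ y)
below-update zero (_ AllV.∷ xs<c) y<c = y<c AllV.∷ xs<c
below-update (suc i) (x<c AllV.∷ xs<c) y<c = x<c AllV.∷ below-update i xs<c y<c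

varsFrom-below : ∀ c m → Below (c + m) (varsFrom c m)
varsFrom-below c zero = AllV.[]
varsFrom-below c (suc m) rewrite +-suc c m = s≤s (m≤m+n c m) AllV.∷ varsFrom-below (suc c) m

varsFrom-++ : ∀ c m n → varsFrom c m ++ᵥ varsFrom (c + m) n ≡ varsFrom c (m + n)
varsFrom-++ c zero n rewrite +-identityʳ c = refl
varsFrom-++ c (suc m) n rewrite +-suc c m = cong (c ∷_) (varsFrom-++ (suc c) m n)

varsFrom-unique : ∀ c m → Unique (toList (varsFrom c m))
varsFrom-unique c zero = []
varsFrom-unique c (suc m) = All.map (λ c<x c≡x → <-irrefl c≡x c<x) (above c m) ∷ varsFrom-unique (suc c) m
  where
  above : ∀ c m → All (c <_) (toList (varsFrom (suc c) m))
  above c zero = []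
  above c (suc m) = ≤-refl ∷ All.map (<-trans (n<1+n c)) (above (suc c) m)

module Valuations {Γ : RankedAlphabet} (k : ℕ) (t : Tree Γ) where

  Val : Set
  Val = Var → Pos t

  _[_≔_] : Val → Var → Pos t → Val
  ρ [ x ≔ u ] = upd {Γ} {k} ρ x u

  _[_≔⃗_] : ∀ {m} → Val → Vec Var m → Vec (Pos t) m → Val
  ρ [ xs ≔⃗ us ] = updV {Γ} {k} ρ xs us

  upd-same : ∀ ρ x u → (ρ [ x ≔ u ]) x ≡ u
  upd-same ρ x u rewrite dec-true (x ≟ⁿ x) refl = refl

  upd-other : ∀ ρ {x y} u → y ≢ x → (ρ [ x ≔ u ]) y ≡ ρ y
  upd-other ρ {x} {y} u y≢x rewrite dec-false (y ≟ⁿ x) y≢x = refl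

  AgreeBelow : Var → Val → Val → Set
  AgreeBelow c ρ ρ′ = ∀ {v} → v < c → ρ v ≡ ρ′ v

  agree-trans : ∀ {c ρ ρ′ ρ″} → AgreeBelow c ρ ρ′ → AgreeBelow c ρ′ ρ″ → AgreeBelow c ρ ρ″
  agree-trans a a′ v<c = trans (a v<c) (a′ v<c)

  agree-mono : ∀ {c d ρ ρ′} → d ≤ c → AgreeBelow c ρ ρ′ → AgreeBelow d ρ ρ′
  agree-mono d≤c a v<d = a (<-≤-trans v<d d≤c)

  agree-upd : ∀ ρ c u → AgreeBelow c ρ (ρ [ c ≔ u ])
  agree-upd ρ c u v<c = sym (upd-other ρ u λ v≡c → <-irrefl v≡c v<c)

  agree-updV : ∀ ρ c {m} (us : Vec (Pos t) m) → AgreeBelow c ρ (ρ [ varsFrom c m ≔⃗ us ])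
  agree-updV ρ c [] v<c = refl
  agree-updV ρ c (u ∷ us) =
    agree-trans (agree-upd ρ c u) (agree-mono (n≤1+n c) (agree-updV (ρ [ c ≔ u ]) (suc c) us))

  vmap-agree : ∀ {c ρ ρ′ m} {xs : Vec Var m} → Below c xs → AgreeBelow c ρ ρ′ → vmap ρ xs ≡ vmap ρ′ xs
  vmap-agree AllV.[] a = refl
  vmap-agree (x<c AllV.∷ xs<c) a = cong₂ _∷_ (a x<c) (vmap-agree xs<c a)

  updV-varsFrom : ∀ ρ c {m} (us : Vec (Pos t) m) → vmap (ρ [ varsFrom c m ≔⃗ us ]) (varsFrom c m) ≡ us
  updV-varsFrom ρ c [] = refl
  updV-varsFrom ρ c (u ∷ us) = cong₂ _∷_
    (trans (sym (agree-updV (ρ [ c ≔ u ]) (suc c) us (n<1+n c))) (upd-same ρ c u))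
    (updV-varsFrom (ρ [ c ≔ u ]) (suc c) us)

  updV-two-blocks : ∀ ρ c {m n} (us : Vec (Pos t) m) (vs : Vec (Pos t) n) →
    let ρ′ = ρ [ varsFrom c m ≔⃗ us ] [ varsFrom (c + m) n ≔⃗ vs ] in
    AgreeBelow c ρ ρ′ × vmap ρ′ (varsFrom c m) ≡ us × vmap ρ′ (varsFrom (c + m) n) ≡ vs
  updV-two-blocks ρ c {m} us vs =
    agree-trans (agree-updV ρ c us) (agree-mono (m≤m+n c m) (agree-updV _ (c + m) vs)) ,
    trans (sym (vmap-agree (varsFrom-below c m) (agree-updV _ (c + m) vs))) (updV-varsFrom ρ c us) ,
    updV-varsFrom _ (c + m) vs

  updated-⇔ : ∀ {m} (P : Pos t → Pos t → Set) i (xs ys : Vec Var m) ρ →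
    (P (ρ (lookup xs i)) (ρ (lookup ys i)) × vmap ρ (xs [ i ]≔ lookup ys i) ≡ vmap ρ ys) ⇔
    (∃[ v ] P (lookup (vmap ρ xs) i) v × vmap ρ ys ≡ vmap ρ xs [ i ]≔ v)
  updated-⇔ P i xs ys ρ = mk⇔
    (λ (p , eq) → _ , subst (λ u → P u _) (sym (lookup-map i ρ xs)) p , sym (trans (sym (map-[]≔ ρ xs i)) eq))
    (λ (v , p , eq) →
      subst (λ w → P w _) (lookup-map i ρ xs) (subst (P _) (sym (ys-i≡ eq)) p) ,
      trans (map-[]≔ ρ xs i) (trans (cong (vmap ρ xs [ i ]≔_) (ys-i≡ eq)) (sym eq)))
    where
    ys-i≡ : ∀ {v} → vmap ρ ys ≡ vmap ρ xs [ i ]≔ v → ρ (lookup ys i) ≡ v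
    ys-i≡ {v} eq =
      trans (sym (lookup-map i ρ ys)) (trans (cong (λ us → lookup us i) eq) (lookup∘update i (vmap ρ xs) v))

-- Formula combinators

module _ {Γ : RankedAlphabet} {k : ℕ} where
  private
    F : Set
    F = Formula Γ k

  ⊤F : F
  ⊤F = allF 0 (eqF 0 0)

  ⊥F : F
  ⊥F = notF ⊤F

  ⋀ : {X : Set} → (X → F) → List X → F
  ⋀ φ [] = ⊤F
  ⋀ φ (x ∷ xs) = andF (φ x) (⋀ φ xs)

  ⋁ : {X : Set} → (X → F) → List X → F
  ⋁ φ [] = ⊥F
  ⋁ φ (x ∷ xs) = orF (φ x) (⋁ φ xs)

  when : {P : Set} → Dec P → F → F
  when (yes _) φ = φ
  when (no _) _ = ⊥F

  signed : Bool → F → F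
  signed true φ = φ
  signed false φ = notF φ

  ∃⃗ : ∀ {m} → Vec Var m → F → F
  ∃⃗ [] φ = φ
  ∃⃗ (x ∷ xs) φ = exF x (∃⃗ xs φ)

  _≐⃗_ : ∀ {m} → Vec Var m → Vec Var m → F
  [] ≐⃗ [] = ⊤F
  (x ∷ xs) ≐⃗ (y ∷ ys) = andF (eqF x y) (xs ≐⃗ ys)

  parentF : Var → Var → F
  parentF x y = ⋁ (λ j → edgF (suc j) x y) (upTo (maxRank Γ))

  FreeBelow : Var → F → Set
  FreeBelow c φ = All (_< c) (fv φ)

  elemᵇ-∈ : ∀ {y zs} → y ∈ zs → elemᵇ {Γ} {k} y zs ≡ true
  elemᵇ-∈ {y} (here refl) rewrite dec-true (y ≟ⁿ y) refl = refl
  elemᵇ-∈ {y} {z ∷ _} (there y∈zs) rewrite elemᵇ-∈ y∈zs = ∨-zeroʳ (y ≡ᵇ z)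

  without-All : ∀ {P : Var → Set} ys zs → All (λ y → P y ⊎ y ∈ zs) ys → All P (without {Γ} {k} ys zs)
  without-All [] zs [] = []
  without-All (y ∷ ys) zs (h ∷ hs) with elemᵇ {Γ} {k} y zs in y∈?zs | h
  ... | true  | _ = without-All ys zs hs
  ... | false | inj₁ p = p ∷ without-All ys zs hs
  ... | false | inj₂ y∈zs with () ← trans (sym (elemᵇ-∈ y∈zs)) y∈?zs

  without-fresh : ∀ {c} ys → All (_< suc c) ys → All (_< c) (without {Γ} {k} ys (c ∷ []))
  without-fresh ys = without-All ys _ ∘ All.map (Sum.map₂ (λ x≡c → here x≡c) ∘ m<1+n⇒m<n∨m≡n)

  exF-free : ∀ {c φ} → FreeBelow (suc c) φ → FreeBelow c (exF c φ)
  exF-free {φ = φ} = without-fresh (fv φ)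

  allF-free : ∀ {c φ} → FreeBelow (suc c) φ → FreeBelow c (allF c φ)
  allF-free {φ = φ} = without-fresh (fv φ)

  ∃⃗-free : ∀ c m {φ} → FreeBelow (c + m) φ → FreeBelow c (∃⃗ (varsFrom c m) φ)
  ∃⃗-free c zero {φ} rewrite +-identityʳ c = id
  ∃⃗-free c (suc m) {φ} φ<c+1+m = exF-free {c = c} {φ = ∃⃗ (varsFrom (suc c) m) φ}
    (∃⃗-free (suc c) m {φ} (subst (λ n → FreeBelow n φ) (+-suc c m) φ<c+1+m))

  ⋀-free : ∀ {X : Set} {c} (φ : X → F) xs → (∀ {x} → x ∈ xs → FreeBelow c (φ x)) → FreeBelow c (⋀ φ xs)
  ⋀-free φ [] _ = []
  ⋀-free φ (x ∷ xs) h = ++⁺ (h (here refl)) (⋀-free φ xs (h ∘ there))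

  ⋁-free : ∀ {X : Set} {c} (φ : X → F) xs → (∀ {x} → x ∈ xs → FreeBelow c (φ x)) → FreeBelow c (⋁ φ xs)
  ⋁-free φ [] _ = []
  ⋁-free φ (x ∷ xs) h = ++⁺ (h (here refl)) (⋁-free φ xs (h ∘ there))

  when-free : ∀ {c P} (d : Dec P) {φ} → FreeBelow c φ → FreeBelow c (when d φ)
  when-free (yes _) φ<c = φ<c
  when-free (no _) _ = []

  signed-free : ∀ {c} b {φ} → FreeBelow c φ → FreeBelow c (signed b φ)
  signed-free true φ<c = φ<c
  signed-free false φ<c = φ<c

  ≐⃗-free : ∀ {c m} {xs ys : Vec Var m} → Below c xs → Below c ys → FreeBelow c (xs ≐⃗ ys)
  ≐⃗-free AllV.[] AllV.[] = []
  ≐⃗-free (x<c AllV.∷ xs<c) (y<c AllV.∷ ys<c) = x<c ∷ y<c ∷ ≐⃗-free xs<c ys<c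

  parentF-free : ∀ {c x y} → x < c → y < c → FreeBelow c (parentF x y)
  parentF-free x<c y<c = ⋁-free _ (upTo (maxRank Γ)) (λ _ → x<c ∷ y<c ∷ [])

  tcF-free : ∀ {c xs ys φ us vs} → FreeBelow c φ → Below c us → Below c vs → FreeBelow c (tcF xs ys φ us vs)
  tcF-free φ<c us<c vs<c = ++⁺ (without-All _ _ (All.map inj₁ φ<c)) (++⁺ (toList⁺ us<c) (toList⁺ vs<c))

  ⋀-dtc : ∀ {X : Set} (φ : X → F) → (∀ x → IsDTC (φ x)) → ∀ xs → IsDTC (⋀ φ xs)
  ⋀-dtc φ h [] = tt
  ⋀-dtc φ h (x ∷ xs) = h x , ⋀-dtc φ h xs

  ⋁-dtc : ∀ {X : Set} (φ : X → F) → (∀ x → IsDTC (φ x)) → ∀ xs → IsDTC (⋁ φ xs)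
  ⋁-dtc φ h [] = tt
  ⋁-dtc φ h (x ∷ xs) = h x , ⋁-dtc φ h xs

  when-dtc : ∀ {P} (d : Dec P) {φ} → (P → IsDTC φ) → IsDTC (when d φ)
  when-dtc (yes p) dtc = dtc p
  when-dtc (no _) _ = tt

  signed-dtc : ∀ b {φ} → IsDTC φ → IsDTC (signed b φ)
  signed-dtc true dtc = dtc
  signed-dtc false dtc = dtc

  ∃⃗-dtc : ∀ {m} (xs : Vec Var m) {φ} → IsDTC φ → IsDTC (∃⃗ xs φ)
  ∃⃗-dtc [] dtc = dtc
  ∃⃗-dtc (x ∷ xs) dtc = ∃⃗-dtc xs dtc

  ≐⃗-dtc : ∀ {m} (xs ys : Vec Var m) → IsDTC (xs ≐⃗ ys)
  ≐⃗-dtc [] [] = tt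
  ≐⃗-dtc (x ∷ xs) (y ∷ ys) = tt , ≐⃗-dtc xs ys

  parentF-dtc : ∀ x y → IsDTC (parentF x y)
  parentF-dtc x y = ⋁-dtc (λ j → edgF (suc j) x y) (λ _ → tt) (upTo (maxRank Γ))

  module _ {t : Tree Γ} where
    open Valuations k t

    ⊤F-sem : ∀ {ρ} → ⟦ ⊤F ⟧ t ρ
    ⊤F-sem _ = refl

    ⊥F-sem : ∀ {ρ} → ¬ ⟦ ⊥F ⟧ t ρ
    ⊥F-sem {ρ} ¬⊤ = ¬⊤ (⊤F-sem {ρ})

    ⋀-sem : ∀ {X} (φ : X → F) xs {ρ} → ⟦ ⋀ φ xs ⟧ t ρ ⇔ All (λ x → ⟦ φ x ⟧ t ρ) xs
    ⋀-sem φ [] {ρ} = mk⇔ (λ _ → []) (λ _ → ⊤F-sem {ρ})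
    ⋀-sem φ (x ∷ xs) = mk⇔
      (λ (h , hs) → h ∷ to (⋀-sem φ xs) hs)
      (λ { (h ∷ hs) → h , from (⋀-sem φ xs) hs })

    ⋁-sem : ∀ {X} (φ : X → F) xs {ρ} → ⟦ ⋁ φ xs ⟧ t ρ ⇔ Any (λ x → ⟦ φ x ⟧ t ρ) xs
    ⋁-sem φ [] {ρ} = mk⇔ (⊥-elim ∘ ⊥F-sem {ρ}) λ ()
    ⋁-sem φ (x ∷ xs) = mk⇔
      [ here , there ∘ to (⋁-sem φ xs) ]′
      (λ { (here h) → inj₁ h ; (there h) → inj₂ (from (⋁-sem φ xs) h) })

    when-sem : ∀ {P} (d : Dec P) φ {ρ} → ⟦ when d φ ⟧ t ρ ⇔ (P × ⟦ φ ⟧ t ρ)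
    when-sem (yes p) φ = mk⇔ (p ,_) proj₂
    when-sem (no ¬p) φ {ρ} = mk⇔ (⊥-elim ∘ ⊥F-sem {ρ}) (⊥-elim ∘ ¬p ∘ proj₁)

    ∃⃗-sem : ∀ {m} (xs : Vec Var m) φ {ρ} → ⟦ ∃⃗ xs φ ⟧ t ρ ⇔ (∃[ us ] ⟦ φ ⟧ t (ρ [ xs ≔⃗ us ]))
    ∃⃗-sem [] φ = mk⇔ ([] ,_) λ { ([] , h) → h }
    ∃⃗-sem (x ∷ xs) φ = mk⇔
      (λ (u , h) → let (us , h′) = to (∃⃗-sem xs φ) h in u ∷ us , h′)
      (λ { (u ∷ us , h) → u , from (∃⃗-sem xs φ) (us , h) })

    ≐⃗-sem : ∀ {m} (xs ys : Vec Var m) {ρ} → ⟦ xs ≐⃗ ys ⟧ t ρ ⇔ (vmap ρ xs ≡ vmap ρ ys)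
    ≐⃗-sem [] [] {ρ} = mk⇔ (λ _ → refl) (λ _ → ⊤F-sem {ρ})
    ≐⃗-sem (x ∷ xs) (y ∷ ys) = mk⇔
      (λ (e , es) → cong₂ _∷_ e (to (≐⃗-sem xs ys) es))
      (λ e → let (e₁ , e₂) = ∷-injective e in e₁ , from (≐⃗-sem xs ys) e₂)

    parentF-sem : ∀ x y {ρ} → ⟦ parentF x y ⟧ t ρ ⇔ (∃[ i ] Edge t i (ρ x) (ρ y))
    parentF-sem x y = mk⇔
      (λ h → let (j , _ , e) = find (to (⋁-sem _ (upTo (maxRank Γ))) h) in suc j , e)
      (λ (i , e) → let (j , i≡1+j , j<max) = edge-index-bound e in
        from (⋁-sem _ (upTo (maxRank Γ))) (lose (∈-upTo⁺ j<max) (subst (λ i → Edge t i _ _) i≡1+j e)))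

    tcF-sem : ∀ {xs ys us vs : Vec Var k} {φ ρ a₀ b₀} {S : Vec (Pos t) k → Vec (Pos t) k → Set} →
      vmap ρ us ≡ a₀ → vmap ρ vs ≡ b₀ → (∀ a b → ⟦ φ ⟧ t (ρ [ xs ≔⃗ a ] [ ys ≔⃗ b ]) ⇔ S a b) →
      ⟦ tcF xs ys φ us vs ⟧ t ρ ⇔ Star S a₀ b₀
    tcF-sem refl refl φ⇔S = mk⇔ (Star.map λ {a b} → to (φ⇔S a b)) (Star.map λ {a b} → from (φ⇔S a b))

-- The translation

unique-length≤ : ∀ {n} {xs : List (Fin n)} → Unique xs → length xs ≤ n
unique-length≤ xs! = injective⇒≤ (lookup-injective xs!)
  where
  lookup-injective : ∀ {A : Set} {xs : List A} → Unique xs →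
    ∀ {i j} → List.lookup xs i ≡ List.lookup xs j → i ≡ j
  lookup-injective (_ ∷ _) {zero} {zero} _ = refl
  lookup-injective (x≢xs ∷ _) {zero} {suc j} eq = ⊥-elim (All.lookup x≢xs (∈-lookup j) eq)
  lookup-injective (x≢xs ∷ _) {suc i} {zero} eq = ⊥-elim (All.lookup x≢xs (∈-lookup i) (sym eq))
  lookup-injective (_ ∷ xs!) {suc i} {suc j} eq = cong suc (lookup-injective xs! eq)

module Translation {Γ : RankedAlphabet} {k : ℕ} (A : PTWA Γ k) where
  open PTWA A
  open DecMembership (_≟ᶠ_ {nX}) using (_∈?_)

  private
    F : Set
    F = Formula Γ k

  -- The pebbles on the stack, top first, each with the variable holding its node.
  Env : Set
  Env = List (Fin nX × Var)

  names : Env → List (Fin nX)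
  names = List.map proj₁

  EnvBelow : Var → Env → Set
  EnvBelow c env = All ((_< c) ∘ proj₂) env

  envBelow-mono : ∀ {c d env} → c ≤ d → EnvBelow c env → EnvBelow d env
  envBelow-mono c≤d = All.map (λ v<c → <-≤-trans v<c c≤d)

  isRootF : Var → Var → F
  isRootF c x = allF c (leqF x c)

  testF : Var → Env → BaseTest Γ k nX → Vec Var k → F
  testF c env (labT i σ) xs = labF σ (lookup xs i)
  testF c env (pebT i x) xs = ⋁ (λ (y , v) → when (x ≟ᶠ y) (eqF (lookup xs i) v)) env
  testF c env (chnoT i zero) xs = isRootF c (lookup xs i)
  testF c env (chnoT i (suc j)) xs = exF c (edgF (suc j) c (lookup xs i))

  moveF : Var → Env → Cmd Γ k nX → Vec Var k → Vec Var k → F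
  moveF c env (up i) xs ys = andF (parentF (lookup ys i) (lookup xs i)) ((xs [ i ]≔ lookup ys i) ≐⃗ ys)
  moveF c env (down i j) xs ys = andF (edgF j (lookup xs i) (lookup ys i)) ((xs [ i ]≔ lookup ys i) ≐⃗ ys)
  moveF c env (test b T) xs ys = andF (xs ≐⃗ ys) (signed b (testF c env T xs))
  moveF c env (drop _ _) xs ys = ⊥F
  moveF c env (retrieve _) xs ys = ⊥F

  entry exit : Var → Vec Var k
  entry c = varsFrom c k
  exit c = varsFrom (c + k) k

  c≤c+k+k : ∀ c → c ≤ c + k + k
  c≤c+k+k c = ≤-trans (m≤m+n c k) (m≤m+n (c + k) k)

  entry-below : ∀ c → Below (c + k + k) (entry c)
  entry-below c = below-mono (m≤m+n (c + k) k) (varsFrom-below c k)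

  exit-below : ∀ c → Below (c + k + k) (exit c)
  exit-below c = varsFrom-below (c + k) k

  -- xs and ys hold the heads before and after, env describes the stack, variables from c on are
  -- free for binding, and f bounds the number of pebbles that can still be dropped.
  mutual
    stepF : ℕ → Var → Env → Fin nQ → Fin nQ → Vec Var k → Vec Var k → F
    stepF f c env p q xs ys = ⋁ (instrStepF f c env p q xs ys) instrs

    instrStepF : ℕ → Var → Env → Fin nQ → Fin nQ → Vec Var k → Vec Var k → Instr A → F
    instrStepF f c env p q xs ys (p₀ , χ , q₀) = when (p₀ ≟ᶠ p) (cmdStepF f c env q xs ys χ q₀)

    cmdStepF : ℕ → Var → Env → Fin nQ → Vec Var k → Vec Var k → Cmd Γ k nX → Fin nQ → F
    cmdStepF f c env q xs ys (drop i x) p′ = excursionF f c env i x p′ q xs ys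
    cmdStepF f c env q xs ys (retrieve _) _ = ⊥F
    cmdStepF f c env q xs ys χ q₀ = when (q₀ ≟ᶠ q) (moveF c env χ xs ys)

    excursionF : ℕ → Var → Env → Fin k → Fin nX → Fin nQ → Fin nQ → Vec Var k → Vec Var k → F
    excursionF zero c env i x p′ q xs ys = ⊥F
    excursionF (suc f) c env i x p′ q xs ys =
      when (¬? (x ∈? names env)) (⋁ (retrieveF f c env i x p′ q xs ys) instrs)

    retrieveF : ℕ → Var → Env → Fin k → Fin nX → Fin nQ → Fin nQ → Vec Var k → Vec Var k → Instr A → F
    retrieveF f c env i x p′ q xs ys (r , χ , q₀) =
      when (χ ≟-cmd retrieve x) (when (q₀ ≟ᶠ q) (reachF f c ((x , lookup xs i) ∷ env) p′ r xs ys))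

    viaF : ℕ → Var → Env → List (Fin nQ) → Fin nQ → Fin nQ → Vec Var k → Vec Var k → F
    viaF f c env [] p q xs ys = stepF f c env p q xs ys
    viaF f c env (r ∷ L) p q xs ys = orF (viaF f c env L p q xs ys)
      (∃⃗ (entry c) (∃⃗ (exit c) (andF (viaF f (c + k + k) env L p r xs (entry c))
        (andF (tcF (entry c) (exit c) (viaF f (c + k + k) env L r r (entry c) (exit c)) (entry c) (exit c))
              (viaF f (c + k + k) env L r q (exit c) ys)))))

    reachF : ℕ → Var → Env → Fin nQ → Fin nQ → Vec Var k → Vec Var k → F
    reachF f c env p q xs ys = orF (when (p ≟ᶠ q) (xs ≐⃗ ys)) (viaF f c env (allFin nQ) p q xs ys)

  heads₀ : Vec Var k
  heads₀ = varsFrom 0 k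

  heads₀-below : Below k heads₀
  heads₀-below = varsFrom-below 0 k

  atRootF : ∀ {m} → Var → Vec Var m → F
  atRootF c [] = ⊤F
  atRootF c (x ∷ xs) = andF (isRootF c x) (atRootF c xs)

  -- With an empty stack a drop is always applicable and a retrieve never is.
  applicableF : Cmd Γ k nX → F
  applicableF (drop _ _) = ⊤F
  applicableF (retrieve _) = ⊥F
  applicableF χ = ∃⃗ (varsFrom k k) (moveF (k + k) [] χ heads₀ (varsFrom k k))

  haltingF : Fin nQ → F
  haltingF p = ⋀ (λ (p₀ , χ , _) → notF (when (p₀ ≟ᶠ p) (applicableF χ))) instrs

  acceptingF : Fin nQ → F
  acceptingF p = when (accepting p ≟ᵇ true) (andF (reachF nX k [] q₀ p heads₀ heads₀) (haltingF p))

  acceptF : F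
  acceptF = ∃⃗ heads₀ (andF (atRootF k heads₀) (⋁ acceptingF (allFin nQ)))

  record Scope (f : ℕ) (c : Var) (env : Env) : Set where
    field
      names-unique  : Unique (names env)
      fuel-suffices : nX ≤ f + length env
      env-below     : EnvBelow c env
  open Scope

  scope₀ : Scope nX k []
  scope₀ = record { names-unique = [] ; fuel-suffices = m≤m+n nX 0 ; env-below = [] }

  scope-mono : ∀ {f c d env} → c ≤ d → Scope f c env → Scope f d env
  scope-mono c≤d sc = record
    { names-unique  = names-unique sc
    ; fuel-suffices = fuel-suffices sc
    ; env-below     = envBelow-mono c≤d (env-below sc)
    }

  scope-push : ∀ {f c env x v} → Scope (suc f) c env → x ∉ names env → v < c → Scope f c ((x , v) ∷ env)
  scope-push {f} {env = env} sc x∉ v<c = record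
    { names-unique  = ¬Any⇒All¬ _ x∉ ∷ names-unique sc
    ; fuel-suffices = subst (nX ≤_) (sym (+-suc f (length env))) (fuel-suffices sc)
    ; env-below     = v<c ∷ env-below sc
    }

  -- Pigeonhole: with no fuel left, all nX pebbles are on the stack.
  scope-exhausted : ∀ {c env x} → Scope zero c env → x ∉ names env → ⊥
  scope-exhausted {env = env} {x} sc x∉ = <-irrefl refl (≤-trans too-many (fuel-suffices sc))
    where
    too-many : suc (length env) ≤ nX
    too-many = subst (λ n → suc n ≤ nX) (length-map proj₁ env)
      (unique-length≤ (¬Any⇒All¬ _ x∉ ∷ names-unique sc))

  isRootF-free : ∀ {c x} → x < c → FreeBelow c (isRootF c x)
  isRootF-free {c} {x} x<c = allF-free {Γ = Γ} {k = k} {c = c} {φ = leqF x c} (m<n⇒m<1+n x<c ∷ n<1+n _ ∷ [])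

  testF-free : ∀ {c} env T {xs} → Below c xs → EnvBelow c env → FreeBelow c (testF c env T xs)
  testF-free env (labT i σ) xs<c _ = lookup⁺ xs<c i ∷ []
  testF-free env (pebT i x) xs<c env<c =
    ⋁-free _ env (λ {e} e∈ → when-free (x ≟ᶠ proj₁ e) (lookup⁺ xs<c i ∷ All.lookup env<c e∈ ∷ []))
  testF-free env (chnoT i zero) xs<c _ = isRootF-free (lookup⁺ xs<c i)
  testF-free {c} env (chnoT i (suc j)) {xs} xs<c _ =
    exF-free {Γ = Γ} {k = k} {c = c} {φ = edgF (suc j) c (lookup xs i)}
      (n<1+n _ ∷ m<n⇒m<1+n (lookup⁺ xs<c i) ∷ [])

  moveF-free : ∀ {c env} χ {xs ys} → Below c xs → Below c ys → EnvBelow c env →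
    FreeBelow c (moveF c env χ xs ys)
  moveF-free (up i) xs<c ys<c _ =
    ++⁺ (parentF-free {Γ = Γ} {k = k} (lookup⁺ ys<c i) (lookup⁺ xs<c i))
        (≐⃗-free (below-update i xs<c (lookup⁺ ys<c i)) ys<c)
  moveF-free (down i j) xs<c ys<c _ =
    ++⁺ (lookup⁺ xs<c i ∷ lookup⁺ ys<c i ∷ []) (≐⃗-free (below-update i xs<c (lookup⁺ ys<c i)) ys<c)
  moveF-free {env = env} (test b T) xs<c ys<c env<c =
    ++⁺ (≐⃗-free xs<c ys<c) (signed-free b (testF-free env T xs<c env<c))
  moveF-free (drop _ _) _ _ _ = []
  moveF-free (retrieve _) _ _ _ = []

  mutual
    stepF-free : ∀ f {c env} p q {xs ys} → Below c xs → Below c ys → EnvBelow c env →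
      FreeBelow c (stepF f c env p q xs ys)
    stepF-free f p q xs<c ys<c env<c =
      ⋁-free _ instrs λ { {p₀ , χ , q₀} _ → when-free (p₀ ≟ᶠ p) (cmdStepF-free f q χ q₀ xs<c ys<c env<c) }

    cmdStepF-free : ∀ f {c env} q χ q₀ {xs ys} → Below c xs → Below c ys → EnvBelow c env →
      FreeBelow c (cmdStepF f c env q xs ys χ q₀)
    cmdStepF-free f q χ@(up _) q₀ xs<c ys<c env<c = when-free (q₀ ≟ᶠ q) (moveF-free χ xs<c ys<c env<c)
    cmdStepF-free f q χ@(down _ _) q₀ xs<c ys<c env<c = when-free (q₀ ≟ᶠ q) (moveF-free χ xs<c ys<c env<c)
    cmdStepF-free f q χ@(test _ _) q₀ xs<c ys<c env<c = when-free (q₀ ≟ᶠ q) (moveF-free χ xs<c ys<c env<c)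
    cmdStepF-free f q (retrieve _) _ _ _ _ = []
    cmdStepF-free f q (drop i x) p′ xs<c ys<c env<c = excursionF-free f i x p′ q xs<c ys<c env<c

    excursionF-free : ∀ f {c env} i x p′ q {xs ys} → Below c xs → Below c ys → EnvBelow c env →
      FreeBelow c (excursionF f c env i x p′ q xs ys)
    excursionF-free zero i x p′ q _ _ _ = []
    excursionF-free (suc f) {env = env} i x p′ q xs<c ys<c env<c = when-free (¬? (x ∈? names env))
      (⋁-free _ instrs λ { {r , χ , q₀} _ → when-free (χ ≟-cmd retrieve x) (when-free (q₀ ≟ᶠ q)
        (reachF-free f p′ r xs<c ys<c (lookup⁺ xs<c i ∷ env<c))) })

    viaF-free : ∀ f {c env} L p q {xs ys} → Below c xs → Below c ys → EnvBelow c env →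
      FreeBelow c (viaF f c env L p q xs ys)
    viaF-free f [] p q xs<c ys<c env<c = stepF-free f p q xs<c ys<c env<c
    viaF-free f {c} {env} (r ∷ L) p q xs<c ys<c env<c = ++⁺ (viaF-free f L p q xs<c ys<c env<c)
      (∃⃗-free c k (∃⃗-free (c + k) k
        (++⁺ (viaF-free f L p r (below-mono (c≤c+k+k c) xs<c) (entry-below c) env<c′)
        (++⁺ (tcF-free {xs = entry c} {ys = exit c} {φ = viaF f (c + k + k) env L r r (entry c) (exit c)}
               (viaF-free f L r r (entry-below c) (exit-below c) env<c′) (entry-below c) (exit-below c))
             (viaF-free f L r q (exit-below c) (below-mono (c≤c+k+k c) ys<c) env<c′)))))
      where
      env<c′ : EnvBelow (c + k + k) env
      env<c′ = envBelow-mono (c≤c+k+k c) env<c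

    reachF-free : ∀ f {c env} p q {xs ys} → Below c xs → Below c ys → EnvBelow c env →
      FreeBelow c (reachF f c env p q xs ys)
    reachF-free f p q xs<c ys<c env<c =
      ++⁺ (when-free (p ≟ᶠ q) (≐⃗-free xs<c ys<c)) (viaF-free f (allFin nQ) p q xs<c ys<c env<c)

  atRootF-free : ∀ {c m} {xs : Vec Var m} → Below c xs → FreeBelow c (atRootF c xs)
  atRootF-free AllV.[] = []
  atRootF-free (x<c AllV.∷ xs<c) = ++⁺ (isRootF-free x<c) (atRootF-free xs<c)

  applicable-move-free : ∀ χ → FreeBelow k (∃⃗ (varsFrom k k) (moveF (k + k) [] χ heads₀ (varsFrom k k)))
  applicable-move-free χ =
    ∃⃗-free k k (moveF-free χ (below-mono (m≤m+n k k) heads₀-below) (varsFrom-below k k) [])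

  applicableF-free : ∀ χ → FreeBelow k (applicableF χ)
  applicableF-free (drop _ _) = []
  applicableF-free (retrieve _) = []
  applicableF-free χ@(up _) = applicable-move-free χ
  applicableF-free χ@(down _ _) = applicable-move-free χ
  applicableF-free χ@(test _ _) = applicable-move-free χ

  acceptF-closed : Closed acceptF
  acceptF-closed = below-zero (∃⃗-free 0 k (++⁺ (atRootF-free heads₀-below) (⋁-free acceptingF (allFin nQ)
    λ {p} _ → when-free (accepting p ≟ᵇ true) (++⁺ (reachF-free nX q₀ p heads₀-below heads₀-below [])
      (⋀-free _ instrs λ { {p₀ , χ , _} _ → when-free (p₀ ≟ᶠ p) (applicableF-free χ) })))))
    where
    below-zero : ∀ {vs} → All (_< 0) vs → vs ≡ []
    below-zero [] = refl

  module Semantics (t : Tree Γ) where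
    open Runs A t
    open Valuations k t
    open StateElimination using (Via; via-sound; via-complete)

    stackOf : Val → Env → Stack A t
    stackOf ρ = List.map (λ (x , v) → x , ρ v)

    stackOf-agree : ∀ {c ρ ρ′} env → EnvBelow c env → AgreeBelow c ρ ρ′ → stackOf ρ env ≡ stackOf ρ′ env
    stackOf-agree [] [] _ = refl
    stackOf-agree (_ ∷ env) (v<c ∷ env<c) agree =
      cong₂ _∷_ (cong (_ ,_) (agree v<c)) (stackOf-agree env env<c agree)

    pebble-free-⇔ : ∀ {x} env ρ → x ∉ names env ⇔ (¬ Any ((_≡ x) ∘ proj₁) (stackOf ρ env))
    pebble-free-⇔ env ρ = mk⇔
      (λ x∉ on-stack → x∉ (Any.map⁺ (Any.map sym (Any.map⁻ on-stack))))
      (λ x∉α x∈ → x∉α (Any.map⁺ (Any.map sym (Any.map⁻ x∈))))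

    chno-zero-⇔ : ∀ {u} → ChNo t u 0 ⇔ (u ≡ root)
    chno-zero-⇔ = mk⇔
      [ proj₁ , (λ (_ , e) → ⊥-elim (edge-index-nonzero e)) ]′
      (λ u≡root → inj₁ (u≡root , refl))

    isRootF-sem : ∀ {c x} → x < c → ∀ ρ → ⟦ isRootF c x ⟧ t ρ ⇔ (ρ x ≡ root)
    isRootF-sem {c} x<c ρ = mk⇔
      (λ h → anc-root (subst₂ (Anc t) (sym (agree-upd ρ c root x<c)) (upd-same ρ c root) (h root)))
      (λ x≡root u → subst₂ (Anc t) (agree-upd ρ c u x<c) (sym (upd-same ρ c u))
        (subst (λ w → Anc t w u) (sym x≡root) anc-here))

    testF-sem : ∀ {c} env T {xs} → Below c xs → ∀ ρ →
      ⟦ testF c env T xs ⟧ t ρ ⇔ HoldsBase A t T (vmap ρ xs) (stackOf ρ env)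
    testF-sem env (labT i σ) {xs} _ ρ rewrite lookup-map i ρ xs = ⇔-id _
    testF-sem env (pebT i x) {xs} _ ρ rewrite lookup-map i ρ xs = mk⇔
      (Any.map⁺ ∘ Any.map (λ {e} → ×-≡,≡→≡ ∘ to (when-sem (x ≟ᶠ proj₁ e) _)) ∘ to (⋁-sem _ env))
      (from (⋁-sem _ env) ∘ Any.map (λ {e} → from (when-sem (x ≟ᶠ proj₁ e) _) ∘ ×-≡,≡←≡) ∘ Any.map⁻)
    testF-sem env (chnoT i zero) {xs} xs<c ρ rewrite lookup-map i ρ xs =
      ⇔-trans (isRootF-sem (lookup⁺ xs<c i) ρ) (⇔-sym chno-zero-⇔)
    testF-sem {c} env (chnoT i (suc j)) {xs} xs<c ρ rewrite lookup-map i ρ xs = mk⇔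
      (λ (u , e) → inj₂ (u , subst₂ (Edge t (suc j)) (upd-same ρ c u) (sym (agree-upd ρ c u x<c)) e))
      [ (λ ()) ∘ proj₂
      , (λ (v , e) → v , subst₂ (Edge t (suc j)) (sym (upd-same ρ c v)) (agree-upd ρ c v x<c) e) ]′
      where
      x<c : lookup xs i < c
      x<c = lookup⁺ xs<c i

    signed-sem : ∀ b {φ : Formula Γ k} {ρ T us α} →
      ⟦ φ ⟧ t ρ ⇔ HoldsBase A t T us α → ⟦ signed b φ ⟧ t ρ ⇔ Holds A t b T us α
    signed-sem true φ⇔T = φ⇔T
    signed-sem false φ⇔T = ¬-cong-⇔ φ⇔T

    moveF-sem : ∀ {c env χ xs ys} → IsMove χ → Below c xs → ∀ ρ {us us′} → vmap ρ xs ≡ us → vmap ρ ys ≡ us′ →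
      ⟦ moveF c env χ xs ys ⟧ t ρ ⇔ Apply A t χ us (stackOf ρ env) us′ (stackOf ρ env)
    moveF-sem {xs = xs} {ys} (up i) _ ρ refl refl =
      ⇔-trans (parentF-sem _ _ ×-⇔ ≐⃗-sem _ ys)
        (⇔-trans (updated-⇔ (λ u v → ∃[ j ] Edge t j v u) i xs ys ρ) (⇔-sym apply-up-⇔))
    moveF-sem {xs = xs} {ys} (down i j) _ ρ refl refl =
      ⇔-trans (⇔-id _ ×-⇔ ≐⃗-sem _ ys) (⇔-trans (updated-⇔ (Edge t j) i xs ys ρ) (⇔-sym apply-down-⇔))
    moveF-sem {env = env} {xs = xs} {ys} (test b T) xs<c ρ refl refl =
      ⇔-trans (≐⃗-sem xs ys ×-⇔ signed-sem b (testF-sem env T xs<c ρ)) (⇔-sym apply-test-⇔)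

    mutual
      stepF-sem : ∀ {f c env} → Scope f c env → ∀ {p q xs ys} → Below c xs → Below c ys → ∀ ρ →
        ⟦ stepF f c env p q xs ys ⟧ t ρ ⇔ LevelStep (stackOf ρ env) (p , vmap ρ xs) (q , vmap ρ ys)
      stepF-sem {f} {c} {env} sc {p} {q} {xs} {ys} xs<c ys<c ρ = mk⇔
        (λ h → let (ι , ι∈ , h′) = find (to (⋁-sem _ instrs) h) in instr-sound ι ι∈ h′)
        (from (⋁-sem _ instrs) ∘ instr-complete)
        where
        α = stackOf ρ env

        move-sem : ∀ {χ} → IsMove χ → ⟦ moveF c env χ xs ys ⟧ t ρ ⇔ Apply A t χ (vmap ρ xs) α (vmap ρ ys) α
        move-sem χ-move = moveF-sem χ-move xs<c ρ refl refl

        move-sound : ∀ {χ q₀} → IsMove χ → (p , χ , q₀) ∈ instrs →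
          ⟦ when (q₀ ≟ᶠ q) (moveF c env χ xs ys) ⟧ t ρ → LevelStep α (p , vmap ρ xs) (q , vmap ρ ys)
        move-sound {q₀ = q₀} χ-move ι∈ h with to (when-sem (q₀ ≟ᶠ q) _) h
        ... | refl , h′ = move ι∈ χ-move (to (move-sem χ-move) h′)

        cmd-sound : ∀ χ q₀ → (p , χ , q₀) ∈ instrs → ⟦ cmdStepF f c env q xs ys χ q₀ ⟧ t ρ →
          LevelStep α (p , vmap ρ xs) (q , vmap ρ ys)
        cmd-sound (up i) _ = move-sound (up i)
        cmd-sound (down i j) _ = move-sound (down i j)
        cmd-sound (test b T) _ = move-sound (test b T)
        cmd-sound (retrieve _) _ _ h = ⊥-elim (⊥F-sem {k = k} {ρ = ρ} h)
        cmd-sound (drop i x) p′ ι∈ h =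
          let (x∉α , r , π , ι′∈) = to (excursionF-sem sc xs<c ys<c ρ) h in excursion ι∈ x∉α π ι′∈

        instr-sound : ∀ ι → ι ∈ instrs → ⟦ instrStepF f c env p q xs ys ι ⟧ t ρ →
          LevelStep α (p , vmap ρ xs) (q , vmap ρ ys)
        instr-sound (p₀ , χ , q₀) ι∈ h with to (when-sem (p₀ ≟ᶠ p) _) h
        ... | refl , h′ = cmd-sound χ q₀ ι∈ h′

        move-complete : ∀ {χ} → IsMove χ → Apply A t χ (vmap ρ xs) α (vmap ρ ys) α →
          ⟦ cmdStepF f c env q xs ys χ q ⟧ t ρ
        move-complete χ-move@(up _) a = from (when-sem (q ≟ᶠ q) _) (refl , from (move-sem χ-move) a)
        move-complete χ-move@(down _ _) a = from (when-sem (q ≟ᶠ q) _) (refl , from (move-sem χ-move) a)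
        move-complete χ-move@(test _ _) a = from (when-sem (q ≟ᶠ q) _) (refl , from (move-sem χ-move) a)

        instr-complete : LevelStep α (p , vmap ρ xs) (q , vmap ρ ys) →
          Any (λ ι → ⟦ instrStepF f c env p q xs ys ι ⟧ t ρ) instrs
        instr-complete (move ι∈ χ-move a) = lose ι∈ (from (when-sem (p ≟ᶠ p) _) (refl , move-complete χ-move a))
        instr-complete (excursion ι∈ x∉α π ι′∈) =
          lose ι∈ (from (when-sem (p ≟ᶠ p) _) (refl , from (excursionF-sem sc xs<c ys<c ρ) (x∉α , _ , π , ι′∈)))

      excursionF-sem : ∀ {f c env} → Scope f c env → ∀ {i x p′ q xs ys} → Below c xs → Below c ys → ∀ ρ →
        ⟦ excursionF f c env i x p′ q xs ys ⟧ t ρ ⇔ Excursion (stackOf ρ env) i x p′ q (vmap ρ xs) (vmap ρ ys)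
      excursionF-sem {zero} {env = env} sc _ _ ρ = mk⇔
        (⊥-elim ∘ ⊥F-sem {k = k} {ρ = ρ})
        (λ (x∉α , _) → ⊥-elim (scope-exhausted sc (from (pebble-free-⇔ env ρ) x∉α)))
      excursionF-sem {suc f} {c} {env} sc {i} {x} {p′} {q} {xs} {ys} xs<c ys<c ρ = mk⇔
        (λ h → let (x∉ , h′) = to (when-sem (¬? (x ∈? names env)) _) h
                   (ι , ι∈ , h″) = find (to (⋁-sem _ instrs) h′) in
               retrieve-sound x∉ ι ι∈ h″)
        (λ (x∉α , r , π , ι∈) → let x∉ = from (pebble-free-⇔ env ρ) x∉α in
          from (when-sem (¬? (x ∈? names env)) _) (x∉ , from (⋁-sem _ instrs) (lose ι∈
            (from (when-sem (retrieve x ≟-cmd retrieve x) _)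
              (refl , from (when-sem (q ≟ᶠ q) _) (refl , from (reach x∉) π))))))
        where
        α = stackOf ρ env

        reach : ∀ {r} → x ∉ names env → ⟦ reachF f c ((x , lookup xs i) ∷ env) p′ r xs ys ⟧ t ρ ⇔
          Star (LevelStep ((x , lookup (vmap ρ xs) i) ∷ α)) (p′ , vmap ρ xs) (r , vmap ρ ys)
        reach x∉ = reachF-sem (scope-push sc x∉ (lookup⁺ xs<c i)) xs<c ys<c ρ
          (cong (λ u → (x , u) ∷ α) (sym (lookup-map i ρ xs))) refl refl

        retrieve-sound : x ∉ names env → ∀ ι → ι ∈ instrs → ⟦ retrieveF f c env i x p′ q xs ys ι ⟧ t ρ →
          Excursion α i x p′ q (vmap ρ xs) (vmap ρ ys)
        retrieve-sound x∉ (r , χ , q₀) ι∈ h with to (when-sem (χ ≟-cmd retrieve x) _) h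
        ... | refl , h′ with to (when-sem (q₀ ≟ᶠ q) _) h′
        ... | refl , h″ = to (pebble-free-⇔ env ρ) x∉ , r , to (reach x∉) h″ , ι∈

      viaF-sem : ∀ {f c env} → Scope f c env → ∀ L {p q xs ys} → Below c xs → Below c ys → ∀ ρ {α us us′} →
        stackOf ρ env ≡ α → vmap ρ xs ≡ us → vmap ρ ys ≡ us′ →
        ⟦ viaF f c env L p q xs ys ⟧ t ρ ⇔ Via (LevelStep α) L p q us us′
      viaF-sem sc [] xs<c ys<c ρ refl refl refl = stepF-sem sc xs<c ys<c ρ
      viaF-sem {f} {c} {env} sc (r ∷ L) {p} {q} {xs} {ys} xs<c ys<c ρ refl refl refl =
        viaF-sem sc L xs<c ys<c ρ refl refl refl ⊎-⇔
        ⇔-trans (⇔-trans (∃⃗-sem (entry c) _) (Σ-⇔ (↠-id _) (∃⃗-sem (exit c) _)))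
          (Σ-⇔ (↠-id _) (Σ-⇔ (↠-id _) (first ×-⇔ (loops ×-⇔ last))))
        where
        α = stackOf ρ env

        sc′ : Scope f (c + k + k) env
        sc′ = scope-mono (c≤c+k+k c) sc

        ρ₂ : Vec (Pos t) k → Vec (Pos t) k → Val
        ρ₂ w w′ = ρ [ entry c ≔⃗ w ] [ exit c ≔⃗ w′ ]

        first : ∀ {w w′} →
          ⟦ viaF f (c + k + k) env L p r xs (entry c) ⟧ t (ρ₂ w w′) ⇔ Via (LevelStep α) L p r (vmap ρ xs) w
        first {w} {w′} = let (agree , entry≡ , _) = updV-two-blocks ρ c w w′ in
          viaF-sem sc′ L (below-mono (c≤c+k+k c) xs<c) (entry-below c) (ρ₂ w w′)
            (sym (stackOf-agree env (env-below sc) agree)) (sym (vmap-agree xs<c agree)) entry≡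

        last : ∀ {w w′} →
          ⟦ viaF f (c + k + k) env L r q (exit c) ys ⟧ t (ρ₂ w w′) ⇔ Via (LevelStep α) L r q w′ (vmap ρ ys)
        last {w} {w′} = let (agree , _ , exit≡) = updV-two-blocks ρ c w w′ in
          viaF-sem sc′ L (exit-below c) (below-mono (c≤c+k+k c) ys<c) (ρ₂ w w′)
            (sym (stackOf-agree env (env-below sc) agree)) exit≡ (sym (vmap-agree ys<c agree))

        loops : ∀ {w w′} →
          ⟦ tcF (entry c) (exit c) (viaF f (c + k + k) env L r r (entry c) (exit c)) (entry c) (exit c) ⟧ t
            (ρ₂ w w′) ⇔ Star (Via (LevelStep α) L r r) w w′
        loops {w} {w′} = let (agree , entry≡ , exit≡) = updV-two-blocks ρ c w w′ in
          tcF-sem {xs = entry c} {ys = exit c} entry≡ exit≡ λ a b →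
            let (agree′ , a≡ , b≡) = updV-two-blocks (ρ₂ w w′) c a b in
            viaF-sem sc′ L (entry-below c) (exit-below c) _
              (sym (stackOf-agree env (env-below sc) (agree-trans agree agree′))) a≡ b≡

      reachF-sem : ∀ {f c env} → Scope f c env → ∀ {p q xs ys} → Below c xs → Below c ys → ∀ ρ {α us us′} →
        stackOf ρ env ≡ α → vmap ρ xs ≡ us → vmap ρ ys ≡ us′ →
        ⟦ reachF f c env p q xs ys ⟧ t ρ ⇔ Star (LevelStep α) (p , us) (q , us′)
      reachF-sem {f} {c} {env} sc {p} {q} {xs} {ys} xs<c ys<c ρ refl refl refl = mk⇔
        [ (λ h → let (p≡q , xs≐ys) = to (when-sem (p ≟ᶠ q) _) h in
            subst (Star _ (p , vmap ρ xs)) (×-≡,≡→≡ (p≡q , to (≐⃗-sem xs ys) xs≐ys)) ε)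
        , via-sound _ (allFin nQ) ∘ to via ]′
        (λ π → [ (λ same → let (p≡q , us≡us′) = ×-≡,≡←≡ same in
                   inj₁ (from (when-sem (p ≟ᶠ q) _) (p≡q , from (≐⃗-sem xs ys) us≡us′)))
               , inj₂ ∘ from via ]′ (via-complete _ (allFin nQ) ∈-allFin π))
        where
        via : ⟦ viaF f c env (allFin nQ) p q xs ys ⟧ t ρ ⇔
          Via (LevelStep (stackOf ρ env)) (allFin nQ) p q (vmap ρ xs) (vmap ρ ys)
        via = viaF-sem sc (allFin nQ) xs<c ys<c ρ refl refl refl

    atRootF-sem : ∀ {c m} {xs : Vec Var m} → Below c xs → ∀ ρ →
      ⟦ atRootF c xs ⟧ t ρ ⇔ (vmap ρ xs ≡ replicate m root)
    atRootF-sem AllV.[] ρ = mk⇔ (λ _ → refl) (λ _ → ⊤F-sem {k = k} {ρ = ρ})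
    atRootF-sem (x<c AllV.∷ xs<c) ρ =
      ⇔-trans (isRootF-sem x<c ρ ×-⇔ atRootF-sem xs<c ρ) (mk⇔ (λ (e , es) → cong₂ _∷_ e es) ∷-injective)

    applicable-move : ∀ {χ} → IsMove χ → ∀ ρ →
      ⟦ ∃⃗ (varsFrom k k) (moveF (k + k) [] χ heads₀ (varsFrom k k)) ⟧ t ρ ⇔
      (∃[ us′ ] ∃[ α′ ] Apply A t χ (vmap ρ heads₀) [] us′ α′)
    applicable-move {χ} χ-move ρ =
      ⇔-trans (∃⃗-sem (varsFrom k k) _) (⇔-trans
        (Σ-⇔ (↠-id _) λ {vs} → moveF-sem χ-move (below-mono (m≤m+n k k) heads₀-below) (ρ [ varsFrom k k ≔⃗ vs ])
          (sym (vmap-agree heads₀-below (agree-updV ρ k vs))) (updV-varsFrom ρ k vs))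
        (mk⇔ (λ (vs , a) → vs , [] , a)
             (λ (vs , α′ , a) → vs , subst (Apply A t χ _ [] vs) (move-keeps-stack χ-move a) a)))

    applicableF-sem : ∀ χ ρ → ⟦ applicableF χ ⟧ t ρ ⇔ (∃[ us′ ] ∃[ α′ ] Apply A t χ (vmap ρ heads₀) [] us′ α′)
    applicableF-sem (drop _ _) ρ = mk⇔ (λ _ → _ , _ , a-drop λ ()) (λ _ → ⊤F-sem {k = k} {ρ = ρ})
    applicableF-sem (retrieve _) ρ = mk⇔ (⊥-elim ∘ ⊥F-sem {k = k} {ρ = ρ}) λ { (_ , _ , ()) }
    applicableF-sem (up i) = applicable-move (up i)
    applicableF-sem (down i j) = applicable-move (down i j)
    applicableF-sem (test b T) = applicable-move (test b T)

    haltingF-sem : ∀ p ρ → ⟦ haltingF p ⟧ t ρ ⇔ Halting A t (p , vmap ρ heads₀ , [])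
    haltingF-sem p ρ = mk⇔
      (λ { h _ (step {χ = χ} ι∈ a) → All.lookup (to (⋀-sem _ instrs) h) ι∈
             (from (when-sem (p ≟ᶠ p) _) (refl , from (applicableF-sem χ ρ) (_ , _ , a))) })
      (λ halt → from (⋀-sem _ instrs) (All.tabulate (stuck halt)))
      where
      stuck : Halting A t (p , vmap ρ heads₀ , []) → ∀ {ι} → ι ∈ instrs →
        ¬ ⟦ when (src A ι ≟ᶠ p) (applicableF (cmd A ι)) ⟧ t ρ
      stuck halt {p₀ , χ , q₀} ι∈ h with to (when-sem (p₀ ≟ᶠ p) _) h
      ... | refl , app = let (_ , _ , a) = to (applicableF-sem χ ρ) app in halt _ (step ι∈ a)

    acceptF-sem : ∀ ρ → ⟦ acceptF ⟧ t ρ ⇔ Accepts A t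
    acceptF-sem ρ = mk⇔ sound complete
      where
      body : F
      body = andF (atRootF k heads₀) (⋁ acceptingF (allFin nQ))

      reach-at : ∀ {p} us → vmap (ρ [ heads₀ ≔⃗ us ]) heads₀ ≡ replicate k root →
        ⟦ reachF nX k [] q₀ p heads₀ heads₀ ⟧ t (ρ [ heads₀ ≔⃗ us ]) ⇔
        Star (LevelStep []) (q₀ , replicate k root) (p , replicate k root)
      reach-at us root≡ = reachF-sem scope₀ heads₀-below heads₀-below (ρ [ heads₀ ≔⃗ us ]) refl root≡ root≡

      sound : ⟦ acceptF ⟧ t ρ → Accepts A t
      sound h =
        let (us , at-root , acc) = to (∃⃗-sem heads₀ body) h
            root≡ = to (atRootF-sem heads₀-below (ρ [ heads₀ ≔⃗ us ])) at-root
            (p , _ , h′) = find (to (⋁-sem _ (allFin nQ)) acc)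
            (accepting≡ , reach , halt) = to (when-sem (accepting p ≟ᵇ true) _) h′ in
        p , accepting≡ , levelStar-sound (to (reach-at us root≡) reach) ,
        subst (λ us → Halting A t (p , us , [])) root≡ (to (haltingF-sem p _) halt)

      complete : Accepts A t → ⟦ acceptF ⟧ t ρ
      complete (p , accepting≡ , π , halt) =
        let roots = replicate k root
            root≡ = updV-varsFrom ρ 0 roots in
        from (∃⃗-sem heads₀ body) (roots , from (atRootF-sem heads₀-below _) root≡ ,
          from (⋁-sem _ (allFin nQ)) (lose (∈-allFin p) (from (when-sem (accepting p ≟ᵇ true) _)
            (accepting≡ , from (reach-at roots root≡) (levelStar-complete π) ,
             from (haltingF-sem p _) (subst (λ us → Halting A t (p , us , [])) (sym root≡) halt)))))

  testF-dtc : ∀ c env T xs → IsDTC (testF c env T xs)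
  testF-dtc c env (labT i σ) xs = tt
  testF-dtc c env (pebT i x) xs = ⋁-dtc _ (λ e → when-dtc (x ≟ᶠ proj₁ e) λ _ → tt) env
  testF-dtc c env (chnoT i zero) xs = tt
  testF-dtc c env (chnoT i (suc j)) xs = tt

  moveF-dtc : ∀ c env χ xs ys → IsDTC (moveF c env χ xs ys)
  moveF-dtc c env (up i) xs ys =
    parentF-dtc {Γ = Γ} (lookup ys i) (lookup xs i) , ≐⃗-dtc (xs [ i ]≔ lookup ys i) ys
  moveF-dtc c env (down i j) xs ys = tt , ≐⃗-dtc (xs [ i ]≔ lookup ys i) ys
  moveF-dtc c env (test b T) xs ys = ≐⃗-dtc xs ys , signed-dtc b (testF-dtc c env T xs)
  moveF-dtc c env (drop _ _) xs ys = tt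
  moveF-dtc c env (retrieve _) xs ys = tt

  atRootF-dtc : ∀ {m} c (xs : Vec Var m) → IsDTC (atRootF c xs)
  atRootF-dtc c [] = tt
  atRootF-dtc c (x ∷ xs) = tt , atRootF-dtc c xs

  applicableF-dtc : ∀ χ → IsDTC (applicableF χ)
  applicableF-dtc (drop _ _) = tt
  applicableF-dtc (retrieve _) = tt
  applicableF-dtc χ@(up _) = ∃⃗-dtc (varsFrom k k) (moveF-dtc (k + k) [] χ heads₀ (varsFrom k k))
  applicableF-dtc χ@(down _ _) = ∃⃗-dtc (varsFrom k k) (moveF-dtc (k + k) [] χ heads₀ (varsFrom k k))
  applicableF-dtc χ@(test _ _) = ∃⃗-dtc (varsFrom k k) (moveF-dtc (k + k) [] χ heads₀ (varsFrom k k))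

  module _ (det : Deterministic A) where
    mutual
      stepF-dtc : ∀ f {c env} → Scope f c env → ∀ p q {xs ys} → Below c xs → Below c ys →
        IsDTC (stepF f c env p q xs ys)
      stepF-dtc f sc p q xs<c ys<c =
        ⋁-dtc _ (λ (p₀ , χ , q₀) → when-dtc (p₀ ≟ᶠ p) λ _ → cmdStepF-dtc f sc q χ q₀ xs<c ys<c) instrs

      cmdStepF-dtc : ∀ f {c env} → Scope f c env → ∀ q χ q₀ {xs ys} → Below c xs → Below c ys →
        IsDTC (cmdStepF f c env q xs ys χ q₀)
      cmdStepF-dtc f {c} {env} _ q χ@(up _) q₀ {xs} {ys} _ _ = when-dtc (q₀ ≟ᶠ q) λ _ → moveF-dtc c env χ xs ys
      cmdStepF-dtc f {c} {env} _ q χ@(down _ _) q₀ {xs} {ys} _ _ = when-dtc (q₀ ≟ᶠ q) λ _ → moveF-dtc c env χ xs ys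
      cmdStepF-dtc f {c} {env} _ q χ@(test _ _) q₀ {xs} {ys} _ _ = when-dtc (q₀ ≟ᶠ q) λ _ → moveF-dtc c env χ xs ys
      cmdStepF-dtc f sc q (retrieve _) _ _ _ = tt
      cmdStepF-dtc f sc q (drop i x) p′ xs<c ys<c = excursionF-dtc f sc i x p′ q xs<c ys<c

      excursionF-dtc : ∀ f {c env} → Scope f c env → ∀ i x p′ q {xs ys} → Below c xs → Below c ys →
        IsDTC (excursionF f c env i x p′ q xs ys)
      excursionF-dtc zero sc i x p′ q _ _ = tt
      excursionF-dtc (suc f) {env = env} sc i x p′ q xs<c ys<c = when-dtc (¬? (x ∈? names env)) λ x∉ →
        ⋁-dtc _ (λ (r , χ , q₀) → when-dtc (χ ≟-cmd retrieve x) λ _ → when-dtc (q₀ ≟ᶠ q) λ _ →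
          reachF-dtc f (scope-push sc x∉ (lookup⁺ xs<c i)) p′ r xs<c ys<c) instrs

      viaF-dtc : ∀ f {c env} → Scope f c env → ∀ L → Unique L → ∀ p q {xs ys} → Below c xs → Below c ys →
        IsDTC (viaF f c env L p q xs ys)
      viaF-dtc f sc [] _ p q xs<c ys<c = stepF-dtc f sc p q xs<c ys<c
      viaF-dtc f {c} {env} sc (r ∷ L) (r≢L ∷ L!) p q xs<c ys<c =
        viaF-dtc f sc L L! p q xs<c ys<c ,
        ∃⃗-dtc (entry c) (∃⃗-dtc (exit c)
          (viaF-dtc f sc′ L L! p r (below-mono (c≤c+k+k c) xs<c) (entry-below c) ,
           (blocks-unique , functional , viaF-dtc f sc′ L L! r r (entry-below c) (exit-below c)) ,
           viaF-dtc f sc′ L L! r q (exit-below c) (below-mono (c≤c+k+k c) ys<c)))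
        where
        sc′ : Scope f (c + k + k) env
        sc′ = scope-mono (c≤c+k+k c) sc

        blocks-unique : Unique (toList (entry c ++ᵥ exit c))
        blocks-unique = subst (Unique ∘ toList) (sym (varsFrom-++ c k k)) (varsFrom-unique c (k + k))

        functional : Functional (viaF f (c + k + k) env L r r (entry c) (exit c)) (entry c) (exit c)
        functional t ρ a b b′ h h′ = cong proj₂
          (StateElimination.via-deterministic _ (Runs.levelStep-deterministic A t det) L L!
            (All¬⇒¬Any r≢L) (All¬⇒¬Any r≢L) (to (loop b) h) (to (loop b′) h′))
          where
          open Semantics t
          open Valuations k t using (_[_≔⃗_]; updV-two-blocks)

          loop : ∀ b →
            ⟦ viaF f (c + k + k) env L r r (entry c) (exit c) ⟧ t (ρ [ entry c ≔⃗ a ] [ exit c ≔⃗ b ]) ⇔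
            StateElimination.Via (Runs.LevelStep A t (stackOf ρ env)) L r r a b
          loop b = let (agree , a≡ , b≡) = updV-two-blocks ρ c a b in
            viaF-sem sc′ L (entry-below c) (exit-below c) _ (sym (stackOf-agree env (env-below sc) agree)) a≡ b≡

      reachF-dtc : ∀ f {c env} → Scope f c env → ∀ p q {xs ys} → Below c xs → Below c ys →
        IsDTC (reachF f c env p q xs ys)
      reachF-dtc f sc p q {xs} {ys} xs<c ys<c =
        when-dtc (p ≟ᶠ q) (λ _ → ≐⃗-dtc xs ys) , viaF-dtc f sc (allFin nQ) (allFin⁺ nQ) p q xs<c ys<c

    acceptF-dtc : IsDTC acceptF
    acceptF-dtc = ∃⃗-dtc heads₀ (atRootF-dtc k heads₀ , ⋁-dtc acceptingF accepting-dtc (allFin nQ))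
      where
      accepting-dtc : ∀ p → IsDTC (acceptingF p)
      accepting-dtc p = when-dtc (accepting p ≟ᵇ true) λ _ →
        reachF-dtc nX scope₀ q₀ p heads₀-below heads₀-below ,
        ⋀-dtc _ (λ (p₀ , χ , _) → when-dtc (p₀ ≟ᶠ p) λ _ → applicableF-dtc χ) instrs

-- The construction works for every k, including k = 0.
lemma5p2 : (Γ : RankedAlphabet) (k : ℕ) → 1 ≤ k →
    (A : PTWA Γ k) → Deterministic A →
    Σ[ φ ∈ Formula Γ k ] (IsDTC φ × Closed φ ×
      ((t : Tree Γ) → (Accepts A t → t ⊨ φ) × (t ⊨ φ → Accepts A t)))
lemma5p2 Γ k _ A det = acceptF , acceptF-dtc det , acceptF-closed ,
  λ t → from (Semantics.acceptF-sem t (λ _ → root)) , to (Semantics.acceptF-sem t (λ _ → root))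
  where open Translation A
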